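{- Fix $i_0\in\{1,\dots,m_0\}$ and fix values of $m_i$ for all $i\neq i_0$. Regarding the following as functions of $m_{i_0}$: (a) $L_+(P_0;m_1,\dots,m_{m_0})$ is a polynomial in $m_{i_0}$ whose degree is the sum of those $m_i$ ($i\neq i_0$) such that $x_i$ is $\preccurlyeq_0$-incomparable with $x_{i_0}$. (b) The values of $L_-(P_0;m_1,\dots,m_{m_0})$ are given by two polynomials in $m_{i_0}$, one for $m_{i_0}$ even and one for $m_{i_0}$ odd, each of degree at most $\lfloor\sum m_i/2\rfloor$, the sum being over those $i$ such that $x_i$ is $\preccurlyeq_0$-incomparable with $x_{i_0}$.
   Context: Let $P_0=(|P_0|,\preccurlyeq_0)$ be a finite poset with $|P_0|=\{x_1,\dots,x_{m_0}\}$, and let $m_1,\dots,m_{m_0}$ be nonnegative integers. For each $i$ let $C_i$ be a chain $x_{i,1}\preccurlyeq_i\dots\preccurlyeq_i x_{i,m_i}$ of $m_i$ elements, the chains pairwise disjoint. Let $P_0*(C_1,\dots,C_{m_0})$ be the lexicographic sum: the set of all $x_{i,j}$, with $x_{i,j}\preccurlyeq x_{i',j'}$ iff either $i\neq i'$ and $x_i\preccurlyeq_0x_{i'}$, or $i=i'$ and $j\leq j'$. Parities of linearizations are taken relative to the reference linear order $x_{1,1},\dots,x_{1,m_1},\dots,x_{m_0,1},\dots,x_{m_0,m_{m_0}}$. $L_+(P_0;m_1,\dots,m_{m_0})$ denotes the number of linearizations of $P_0*(C_1,\dots,C_{m_0})$ and $L_-(P_0;m_1,\dots,m_{m_0})$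 its sign-imbalance (number of even minus number of odd linearizations). -}

module Defs where

open import Data.Nat as ℕ using (ℕ; zero; suc; _<ᵇ_; _≡ᵇ_; _∸_)
open import Data.Integer as ℤ using (ℤ)
open import Data.Rational as ℚ using (ℚ; _/_)
open import Data.Fin as Fin using (Fin; toℕ)
open import Data.Bool using (T?; Bool; true; false; if_then_else_; not; _∧_; _∨_)
open import Data.List as List using (List; []; _∷_; map; concatMap; length; filter; upTo; allFin; foldr)
open import Data.Nat.ListAction using (sum)
open import Data.Vec as Vec using (Vec)
open import Data.Product using (_×_; _,_)
open import Relation.Nullary using (does)
open import Level using (Level)
open import Relation.Binary using (Rel; Decidable)

-- Elements of the lexicographic sum: x_{i,j} is encoded as (i , j-1),
-- i : Fin m0 indexes the poset P_0, j-1 < m_i indexes the chain C_i.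
Elt : ℕ → Set
Elt m0 = Fin m0 × ℕ

module _ {ℓ : Level} {m0 : ℕ} {_≼₀_ : Rel (Fin m0) ℓ} (dec : Decidable _≼₀_) where

  _≼₀ᵇ_ : Fin m0 → Fin m0 → Bool
  i ≼₀ᵇ i' = does (dec i i')

  _≼ᵇ_ : Elt m0 → Elt m0 → Bool
  (i , j) ≼ᵇ (i' , j') =
    (not (does (i Fin.≟ i')) ∧ (i ≼₀ᵇ i')) ∨ (does (i Fin.≟ i') ∧ (j ℕ.≤ᵇ j'))

  incomparableᵇ : Fin m0 → Fin m0 → Bool
  incomparableᵇ i i0 = not (i ≼₀ᵇ i0) ∧ not (i0 ≼₀ᵇ i)

  incompSum : Fin m0 → (Fin m0 → ℕ) → ℕ
  incompSum i0 m = sum (map (λ i → if incomparableᵇ i i0 then m i else 0) (allFin m0))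

  -- a list (without repetitions) is a linear extension iff no later element
  -- is ≼ an earlier one
  isLinearizationᵇ : List (Elt m0) → Bool
  isLinearizationᵇ [] = true
  isLinearizationᵇ (x ∷ xs) = foldr (λ y b → not (y ≼ᵇ x) ∧ b) true xs ∧ isLinearizationᵇ xs

-- the reference linear order x_{1,1},...,x_{1,m_1},...,x_{m0,m_{m0}}, strict
_<refᵇ_ : ∀ {m0} → Elt m0 → Elt m0 → Bool
(i , j) <refᵇ (i' , j') = (toℕ i <ᵇ toℕ i') ∨ ((toℕ i ≡ᵇ toℕ i') ∧ (j <ᵇ j'))

elements : ∀ {m0} → (Fin m0 → ℕ) → List (Elt m0)
elements {m0} m = concatMap (λ i → map (i ,_) (upTo (m i))) (allFin m0)

insertions : ∀ {A : Set} → A → List A → List (List A)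
insertions x [] = (x ∷ []) ∷ []
insertions x (y ∷ ys) = (x ∷ y ∷ ys) ∷ map (y ∷_) (insertions x ys)

permutations : ∀ {A : Set} → List A → List (List A)
permutations [] = [] ∷ []
permutations (x ∷ xs) = concatMap (insertions x) (permutations xs)

inversions : ∀ {m0} → List (Elt m0) → ℕ
inversions [] = 0
inversions (x ∷ xs) = length (filter (λ y → T? (y <refᵇ x)) xs) ℕ.+ inversions xs

parityFromInv : ℕ → ℤ
parityFromInv zero = ℤ.+ 1
parityFromInv (suc n) = ℤ.- parityFromInv n

module _ {ℓ : Level} {m0 : ℕ} {_≼₀_ : Rel (Fin m0) ℓ} (dec : Decidable _≼₀_) where

  linearizations : (Fin m0 → ℕ) → List (List (Elt m0))
  linearizations m =
    filter (λ l → T? (isLinearizationᵇ dec l)) (permutations (elements m))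

  Lplus : (Fin m0 → ℕ) → ℕ
  Lplus m = length (linearizations m)

  Lminus : (Fin m0 → ℕ) → ℤ
  Lminus m = foldr ℤ._+_ (ℤ.+ 0) (map (λ l → parityFromInv (inversions l)) (linearizations m))

update : ∀ {m0} → (Fin m0 → ℕ) → Fin m0 → ℕ → Fin m0 → ℕ
update m i0 n i = if does (i Fin.≟ i0) then n else m i

-- polynomials over ℚ as coefficient vectors c_0, c_1, ..., c_d (Horner evaluation)
evalPoly : ∀ {k} → Vec ℚ k → ℚ → ℚ
evalPoly Vec.[] x = ℚ.0ℚ
evalPoly (c Vec.∷ cs) x = c ℚ.+ x ℚ.* evalPoly cs x

ℕtoℚ : ℕ → ℚ
ℕtoℚ n = ℤ.+ n / 1

ℤtoℚ : ℤ → ℚ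
ℤtoℚ z = z / 1

-- Growing m_{i0} from n to n + 1 adds a top element t to C_{i0}.  In
-- a linearization l, t must go after the last element below x_{i0} and before
-- the first element above it, i.e. into the free prefix of the window of l
-- (Insertion).  Both L₊ and L₋ are signed counts for a sign character σ
-- (Signs).  Since a sum over all permutations only depends on the list up to
-- reordering (ListSums), iterating the insertion step (Growth, ClosedForm)
-- writes the count for m_{i0} = n as a sum over the linear orders l with
-- m_{i0} = 0 of ±σ(n c_l) [n + j_l, j_l]_{q = σ 1}, where j_l ≤ incompSum is
-- the length of the free prefix (WindowBound).  These Gaussian binomials are
-- polynomials in n of degree j_l, and for q = -1 in ⌊n/2⌋ of degree ⌊j_l/2⌋
-- on each parity class (InterleavingPolys; computed in the binomial basis of
-- BinomialBasis and converted to the monomial basis in MonomialBasis).  A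
-- linearization with j_l = incompSum (Extremal) makes the top coefficient of
-- L₊ nonzero.
module Submission where

open import Data.Nat as ℕ using (ℕ)
open import Data.Fin using (Fin)
open import Relation.Binary using (Rel; Decidable; IsPartialOrder)
open import Relation.Binary.PropositionalEquality using (_≡_)
open import Level using (0ℓ)

module ListSums where

  open import Data.Integer using (ℤ; 0ℤ; _+_; _*_)
  import Data.Integer.Properties as ℤ
  open import Data.List using (List; []; _∷_; _++_; map; concat; concatMap)
  open import Data.List.Relation.Unary.All using (All; []; _∷_)
  open import Data.List.Relation.Binary.Permutation.Propositional as ↭ using (_↭_; prep; swap)
  open import Relation.Binary.PropositionalEquality
  open import Data.Integer.Solver using (module +-*-Solver)
  open import Defs using (insertions; permutations)

  open +-*-Solver using (solve; _:+_; _:=_)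

  sumℤ : {A : Set} → (A → ℤ) → List A → ℤ
  sumℤ f [] = 0ℤ
  sumℤ f (x ∷ xs) = f x + sumℤ f xs

  module _ {A : Set} where

    sumℤ-++ : (f : A → ℤ) (xs ys : List A) → sumℤ f (xs ++ ys) ≡ sumℤ f xs + sumℤ f ys
    sumℤ-++ f [] ys = sym (ℤ.+-identityˡ _)
    sumℤ-++ f (x ∷ xs) ys = trans (cong (f x +_) (sumℤ-++ f xs ys)) (sym (ℤ.+-assoc (f x) _ _))

    sumℤ-cong : {f g : A → ℤ} → (∀ x → f x ≡ g x) → (xs : List A) → sumℤ f xs ≡ sumℤ g xs
    sumℤ-cong e [] = refl
    sumℤ-cong e (x ∷ xs) = cong₂ _+_ (e x) (sumℤ-cong e xs)

    sumℤ-congᴬ : {f g : A → ℤ} (xs : List A) → All (λ x → f x ≡ g x) xs → sumℤ f xs ≡ sumℤ g xs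
    sumℤ-congᴬ [] [] = refl
    sumℤ-congᴬ (x ∷ xs) (e ∷ es) = cong₂ _+_ e (sumℤ-congᴬ xs es)

    sumℤ-+ : (f g : A → ℤ) (xs : List A) → sumℤ (λ x → f x + g x) xs ≡ sumℤ f xs + sumℤ g xs
    sumℤ-+ f g [] = refl
    sumℤ-+ f g (x ∷ xs) rewrite sumℤ-+ f g xs =
      solve 4 (λ a b c d → (a :+ b) :+ (c :+ d) := (a :+ c) :+ (b :+ d)) refl
        (f x) (g x) (sumℤ f xs) (sumℤ g xs)

    sumℤ-scale : (c : ℤ) (f : A → ℤ) (xs : List A) → sumℤ (λ x → c * f x) xs ≡ c * sumℤ f xs
    sumℤ-scale c f [] = sym (ℤ.*-zeroʳ c)
    sumℤ-scale c f (x ∷ xs) = trans (cong (c * f x +_) (sumℤ-scale c f xs)) (sym (ℤ.*-distribˡ-+ c (f x) _))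

  module _ {A B : Set} where

    sumℤ-map : (f : B → ℤ) (g : A → B) (xs : List A) → sumℤ f (map g xs) ≡ sumℤ (λ x → f (g x)) xs
    sumℤ-map f g [] = refl
    sumℤ-map f g (x ∷ xs) = cong (f (g x) +_) (sumℤ-map f g xs)

    sumℤ-concatMap : (f : B → ℤ) (g : A → List B) (xs : List A) →
                     sumℤ f (concatMap g xs) ≡ sumℤ (λ x → sumℤ f (g x)) xs
    sumℤ-concatMap f g [] = refl
    sumℤ-concatMap f g (x ∷ xs) =
      trans (sumℤ-++ f (g x) (concat (map g xs))) (cong (sumℤ f (g x) +_) (sumℤ-concatMap f g xs))

  module _ {A : Set} where

    insertionSum : A → (List A → ℤ) → List A → ℤ
    insertionSum x f l = sumℤ f (insertions x l)

    insertionSum-∷ : (x z : A) (f : List A → ℤ) (l : List A) →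
                     insertionSum x f (z ∷ l) ≡ f (x ∷ z ∷ l) + insertionSum x (λ k → f (z ∷ k)) l
    insertionSum-∷ x z f l = cong (f (x ∷ z ∷ l) +_) (sumℤ-map f (z ∷_) (insertions x l))

    sumℤ-permutations-∷ : (f : List A → ℤ) (x : A) (xs : List A) →
      sumℤ f (permutations (x ∷ xs)) ≡ sumℤ (insertionSum x f) (permutations xs)
    sumℤ-permutations-∷ f x xs = sumℤ-concatMap f (insertions x) (permutations xs)

    doubleInsertionSum : A → A → (List A → ℤ) → List A → ℤ
    doubleInsertionSum x y f l = sumℤ (insertionSum x f) (insertions y l)

    doubleInsertionSum-∷ : (x y z : A) (f : List A → ℤ) (l : List A) →
      doubleInsertionSum x y f (z ∷ l) ≡
        (f (x ∷ y ∷ z ∷ l) + f (y ∷ x ∷ z ∷ l))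
        + (insertionSum x (λ k → f (y ∷ z ∷ k)) l + insertionSum y (λ k → f (x ∷ z ∷ k)) l)
        + doubleInsertionSum x y (λ k → f (z ∷ k)) l
    doubleInsertionSum-∷ x y z f l =
      begin
        insertionSum x f (y ∷ z ∷ l) + sumℤ (insertionSum x f) (map (z ∷_) (insertions y l))
      ≡⟨ cong₂ _+_ (trans (insertionSum-∷ x y f (z ∷ l)) (cong (a +_) (insertionSum-∷ x z (λ k → f (y ∷ k)) l)))
                   (trans (sumℤ-map (insertionSum x f) (z ∷_) (insertions y l))
                     (trans (sumℤ-cong (insertionSum-∷ x z f) (insertions y l))
                            (sumℤ-+ (λ k → f (x ∷ z ∷ k)) (insertionSum x (λ k → f (z ∷ k))) (insertions y l)))) ⟩
        (a + (b + P)) + (Q + D)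
      ≡⟨ solve 5 (λ a b p q d → (a :+ (b :+ p)) :+ (q :+ d) := ((a :+ b) :+ (p :+ q)) :+ d) refl a b P Q D ⟩
        (a + b) + (P + Q) + D
      ∎
      where
      open ≡-Reasoning
      a b P Q D : ℤ
      a = f (x ∷ y ∷ z ∷ l)
      b = f (y ∷ x ∷ z ∷ l)
      P = insertionSum x (λ k → f (y ∷ z ∷ k)) l
      Q = insertionSum y (λ k → f (x ∷ z ∷ k)) l
      D = doubleInsertionSum x y (λ k → f (z ∷ k)) l

    doubleInsertionSum-comm : (x y : A) (f : List A → ℤ) (l : List A) →
      doubleInsertionSum x y f l ≡ doubleInsertionSum y x f l
    doubleInsertionSum-comm x y f [] =
      cong (_+ 0ℤ) (trans (cong (f (x ∷ y ∷ []) +_) (ℤ.+-identityʳ _))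
                   (trans (ℤ.+-comm (f (x ∷ y ∷ [])) (f (y ∷ x ∷ [])))
                          (cong (f (y ∷ x ∷ []) +_) (sym (ℤ.+-identityʳ _)))))
    doubleInsertionSum-comm x y f (z ∷ l) =
      begin
        doubleInsertionSum x y f (z ∷ l)
      ≡⟨ doubleInsertionSum-∷ x y z f l ⟩
        (f (x ∷ y ∷ z ∷ l) + f (y ∷ x ∷ z ∷ l)) + (P + Q) + doubleInsertionSum x y (λ k → f (z ∷ k)) l
      ≡⟨ cong₃ (λ u v w → u + v + w) (ℤ.+-comm (f (x ∷ y ∷ z ∷ l)) _) (ℤ.+-comm P Q)
               (doubleInsertionSum-comm x y (λ k → f (z ∷ k)) l) ⟩
        (f (y ∷ x ∷ z ∷ l) + f (x ∷ y ∷ z ∷ l)) + (Q + P) + doubleInsertionSum y x (λ k → f (z ∷ k)) l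
      ≡⟨ sym (doubleInsertionSum-∷ y x z f l) ⟩
        doubleInsertionSum y x f (z ∷ l)
      ∎
      where
      open ≡-Reasoning
      P Q : ℤ
      P = insertionSum x (λ k → f (y ∷ z ∷ k)) l
      Q = insertionSum y (λ k → f (x ∷ z ∷ k)) l
      cong₃ : ∀ (h : ℤ → ℤ → ℤ → ℤ) {a a' b b' c c'} → a ≡ a' → b ≡ b' → c ≡ c' → h a b c ≡ h a' b' c'
      cong₃ h refl refl refl = refl

    sumℤ-permutations-↭ : {xs ys : List A} → xs ↭ ys → (f : List A → ℤ) →
                          sumℤ f (permutations xs) ≡ sumℤ f (permutations ys)
    sumℤ-permutations-↭ ↭.refl f = refl
    sumℤ-permutations-↭ {x ∷ xs} {x ∷ ys} (prep x p) f =
      trans (sumℤ-permutations-∷ f x xs)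
        (trans (sumℤ-permutations-↭ p _) (sym (sumℤ-permutations-∷ f x ys)))
    sumℤ-permutations-↭ {x ∷ y ∷ xs} {y ∷ x ∷ ys} (swap x y p) f =
      begin
        sumℤ f (permutations (x ∷ y ∷ xs))
      ≡⟨ trans (sumℤ-permutations-∷ f x (y ∷ xs)) (sumℤ-permutations-∷ _ y xs) ⟩
        sumℤ (doubleInsertionSum x y f) (permutations xs)
      ≡⟨ sumℤ-permutations-↭ p _ ⟩
        sumℤ (doubleInsertionSum x y f) (permutations ys)
      ≡⟨ sumℤ-cong (doubleInsertionSum-comm x y f) (permutations ys) ⟩
        sumℤ (doubleInsertionSum y x f) (permutations ys)
      ≡⟨ sym (trans (sumℤ-permutations-∷ f y (x ∷ ys)) (sumℤ-permutations-∷ _ x ys)) ⟩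
        sumℤ f (permutations (y ∷ x ∷ ys))
      ∎
      where open ≡-Reasoning
    sumℤ-permutations-↭ (↭.trans p q) f = trans (sumℤ-permutations-↭ p f) (sumℤ-permutations-↭ q f)

module ListFacts where

  open import Data.Nat as ℕ using (ℕ; suc; _≤_; _<_; _≤ᵇ_; z≤n; s≤s)
  import Data.Nat.Properties as ℕ
  open import Data.Integer as ℤ using (+_; 0ℤ; 1ℤ)
  import Data.Integer.Properties as ℤ
  open import Data.Bool using (Bool; true; false; T; if_then_else_)
  open import Data.List using (List; []; _∷_; _++_; length; filter; concatMap)
  open import Data.List.Properties using (length-filter)
  open import Data.List.Relation.Unary.All as All using (All; []; _∷_)
  import Data.List.Relation.Unary.All.Properties as All
  open import Data.List.Relation.Unary.AllPairs using (AllPairs; []; _∷_)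
  open import Data.List.Relation.Unary.Any using (here; there)
  open import Data.List.Relation.Unary.Unique.Propositional using (Unique)
  open import Data.List.Membership.Propositional using (_∈_)
  open import Data.List.Membership.Propositional.Properties using (∈-concat⁺′; ∈-map⁺)
  open import Data.List.Relation.Binary.Permutation.Propositional as ↭
    using (_↭_; prep; swap; ↭-refl; ↭-sym; ↭-trans; ↭-reflexive; ↭⇒↭ₛ)
  import Data.List.Relation.Binary.Permutation.Propositional.Properties as ↭
  import Data.List.Relation.Binary.Permutation.Setoid.Properties as ↭ₛ
  open import Relation.Binary.PropositionalEquality
  open import Relation.Nullary using (¬_)
  open import Relation.Nullary.Decidable using (T?)
  open import Defs using (insertions; permutations)
  open ListSums using (sumℤ)

  indicator : Bool → ℕ
  indicator true = 1
  indicator false = 0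

  count : {A : Set} → (A → Bool) → List A → ℕ
  count b l = length (filter (λ y → T? (b y)) l)

  module _ {A : Set} where

    count-∷ : (b : A → Bool) (y : A) (l : List A) → count b (y ∷ l) ≡ indicator (b y) ℕ.+ count b l
    count-∷ b y l with b y
    ... | true = refl
    ... | false = refl

    count-++ : (b : A → Bool) (xs ys : List A) → count b (xs ++ ys) ≡ count b xs ℕ.+ count b ys
    count-++ b [] ys = refl
    count-++ b (x ∷ xs) ys =
      trans (count-∷ b x (xs ++ ys))
        (trans (cong (indicator (b x) ℕ.+_) (count-++ b xs ys))
          (trans (sym (ℕ.+-assoc (indicator (b x)) _ _)) (cong (ℕ._+ count b ys) (sym (count-∷ b x xs)))))

    count-↭ : (b : A → Bool) {xs ys : List A} → xs ↭ ys → count b xs ≡ count b ys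
    count-↭ b p = ↭.↭-length (↭.filter-↭ (λ y → T? (b y)) p)

    count-≤-length : (b : A → Bool) (xs : List A) → count b xs ≤ length xs
    count-≤-length b xs = length-filter (λ y → T? (b y)) xs

    count-allTrue : (b : A → Bool) (xs : List A) → All (λ x → b x ≡ true) xs → count b xs ≡ length xs
    count-allTrue b [] [] = refl
    count-allTrue b (x ∷ xs) (e ∷ es) =
      trans (count-∷ b x xs) (trans (cong (λ c → indicator c ℕ.+ count b xs) e) (cong suc (count-allTrue b xs es)))

    count-allFalse : (b : A → Bool) (xs : List A) → All (λ x → b x ≡ false) xs → count b xs ≡ 0
    count-allFalse b [] [] = refl
    count-allFalse b (x ∷ xs) (e ∷ es) =
      trans (count-∷ b x xs) (trans (cong (λ c → indicator c ℕ.+ count b xs) e) (count-allFalse b xs es))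

    count-pos : (b : A → Bool) {w : A} (xs : List A) → w ∈ xs → b w ≡ true → 1 ≤ count b xs
    count-pos b (x ∷ xs) (here refl) e rewrite count-∷ b x xs | e = s≤s z≤n
    count-pos b (x ∷ xs) (there w∈) e rewrite count-∷ b x xs =
      ℕ.≤-trans (count-pos b xs w∈ e) (ℕ.m≤n+m _ _)

    private
      indicator-mono : {c c' : Bool} → (c ≡ true → c' ≡ true) → indicator c ≤ indicator c'
      indicator-mono {false} f = z≤n
      indicator-mono {true} f rewrite f refl = s≤s z≤n

    count-mono : (b b' : A → Bool) → (∀ x → b x ≡ true → b' x ≡ true) →
                 (xs : List A) → count b xs ≤ count b' xs
    count-mono b b' f [] = z≤n
    count-mono b b' f (x ∷ xs) rewrite count-∷ b x xs | count-∷ b' x xs =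
      ℕ.+-mono-≤ (indicator-mono (f x)) (count-mono b b' f xs)

    count-mono-< : (b b' : A → Bool) → (∀ x → b x ≡ true → b' x ≡ true) →
                   ∀ {w} xs → w ∈ xs → b w ≡ false → b' w ≡ true → count b xs < count b' xs
    count-mono-< b b' f (x ∷ xs) (here refl) bw bw' rewrite count-∷ b x xs | count-∷ b' x xs | bw | bw' =
      s≤s (count-mono b b' f xs)
    count-mono-< b b' f (x ∷ xs) (there w∈) bw bw' rewrite count-∷ b x xs | count-∷ b' x xs =
      ℕ.+-mono-≤-< (indicator-mono (f x)) (count-mono-< b b' f xs w∈ bw bw')

    sumℤ-indicator : (b : A → Bool) (xs : List A) → sumℤ (λ l → if b l then 1ℤ else 0ℤ) xs ≡ + count b xs
    sumℤ-indicator b [] = refl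
    sumℤ-indicator b (x ∷ xs) =
      trans (cong (λ z → (if b x then 1ℤ else 0ℤ) ℤ.+ z) (sumℤ-indicator b xs))
            (trans (step (b x)) (cong +_ (sym (count-∷ b x xs))))
      where
      step : ∀ c → (if c then 1ℤ else 0ℤ) ℤ.+ + count b xs ≡ + (indicator c ℕ.+ count b xs)
      step true = refl
      step false = ℤ.+-identityˡ _

    insertions-↭ : (x : A) (l : List A) → All (λ k → k ↭ x ∷ l) (insertions x l)
    insertions-↭ x [] = ↭-refl ∷ []
    insertions-↭ x (y ∷ l) =
      ↭-refl ∷ All.map⁺ (All.map (λ p → ↭-trans (prep y p) (swap y x ↭-refl)) (insertions-↭ x l))

    permutations-↭ : (xs : List A) → All (_↭ xs) (permutations xs)
    permutations-↭ [] = ↭-refl ∷ []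
    permutations-↭ (x ∷ xs) =
      All.concat⁺ (All.map⁺ (All.tabulate (λ {l} l∈ →
        All.map (λ k↭ → ↭-trans k↭ (prep x (All.lookup (permutations-↭ xs) l∈))) (insertions-↭ x l))))

    permutations-All : {P : A → Set} (xs : List A) → All P xs → All (All P) (permutations xs)
    permutations-All xs pxs = All.map (λ l↭ → ↭.All-resp-↭ (↭-sym l↭) pxs) (permutations-↭ xs)

    count-insertions : (b : A → Bool) (x : A) (l : List A) →
                       All (λ k → count b k ≡ indicator (b x) ℕ.+ count b l) (insertions x l)
    count-insertions b x l = All.map (λ k↭ → trans (count-↭ b k↭) (count-∷ b x l)) (insertions-↭ x l)

    count-permutations : (b : A → Bool) (xs : List A) → All (λ l → count b l ≡ count b xs) (permutations xs)
    count-permutations b xs = All.map (count-↭ b) (permutations-↭ xs)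

    ∈-permutations : (xs : List A) → xs ∈ permutations xs
    ∈-permutations [] = here refl
    ∈-permutations (x ∷ xs) = ∈-concat⁺′ (front xs) (∈-map⁺ (insertions x) (∈-permutations xs))
      where
      front : ∀ ys → (x ∷ ys) ∈ insertions x ys
      front [] = here refl
      front (y ∷ ys) = here refl

    Unique-↭ : {xs ys : List A} → xs ↭ ys → Unique xs → Unique ys
    Unique-↭ p = ↭ₛ.Unique-resp-↭ (setoid A) (↭⇒↭ₛ p)

  module _ {A B : Set} (f : A → List B) where

    concatMap-congᴬ : (g : A → List B) (xs : List A) → All (λ x → f x ≡ g x) xs → concatMap f xs ≡ concatMap g xs
    concatMap-congᴬ g [] [] = refl
    concatMap-congᴬ g (x ∷ xs) (e ∷ es) = cong₂ _++_ e (concatMap-congᴬ g xs es)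

    concatMap-↭ : {xs ys : List A} → xs ↭ ys → concatMap f xs ↭ concatMap f ys
    concatMap-↭ ↭.refl = ↭-refl
    concatMap-↭ (prep x p) = ↭.++⁺ˡ (f x) (concatMap-↭ p)
    concatMap-↭ (swap x y p) = ↭-trans (↭.++⁺ˡ (f x) (↭.++⁺ˡ (f y) (concatMap-↭ p))) (↭.shifts (f x) (f y))
    concatMap-↭ (↭.trans p q) = ↭-trans (concatMap-↭ p) (concatMap-↭ q)

  module SortByKey {A : Set} (κ : A → ℕ) where

    insert : A → List A → List A
    insert x [] = x ∷ []
    insert x (y ∷ ys) = if κ x ≤ᵇ κ y then x ∷ y ∷ ys else y ∷ insert x ys

    sort : List A → List A
    sort [] = []
    sort (x ∷ xs) = insert x (sort xs)

    insert-↭ : (x : A) (ys : List A) → insert x ys ↭ x ∷ ys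
    insert-↭ x [] = ↭-refl
    insert-↭ x (y ∷ ys) with κ x ≤ᵇ κ y
    ... | true = ↭-refl
    ... | false = ↭-trans (prep y (insert-↭ x ys)) (swap y x ↭-refl)

    sort-↭ : (xs : List A) → sort xs ↭ xs
    sort-↭ [] = ↭-refl
    sort-↭ (x ∷ xs) = ↭-trans (insert-↭ x (sort xs)) (prep x (sort-↭ xs))

    KeyOrdered : List A → Set
    KeyOrdered = AllPairs (λ a b → κ a ≤ κ b)

    insert-ordered : (x : A) (ys : List A) → KeyOrdered ys → KeyOrdered (insert x ys)
    insert-ordered x [] [] = [] ∷ []
    insert-ordered x (y ∷ ys) (y≤ ∷ s) with κ x ≤ᵇ κ y in e
    ... | true = (x≤y ∷ All.map (ℕ.≤-trans x≤y) y≤) ∷ (y≤ ∷ s)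
      where x≤y = ℕ.≤ᵇ⇒≤ (κ x) (κ y) (subst T (sym e) _)
    ... | false = ↭.All-resp-↭ (↭-sym (insert-↭ x ys)) (y≤x ∷ y≤) ∷ insert-ordered x ys s
      where y≤x = ℕ.<⇒≤ (ℕ.≰⇒> (λ le → subst T e (ℕ.≤⇒≤ᵇ le)))

    sort-ordered : (xs : List A) → KeyOrdered (sort xs)
    sort-ordered [] = []
    sort-ordered (x ∷ xs) = insert-ordered x (sort xs) (sort-ordered xs)

  concatMap-↭-∷ : {A B : Set} (f g : A → List B) {x : A} {t : B} →
                  (∀ a → ¬ a ≡ x → g a ≡ f a) → g x ↭ t ∷ f x →
                  (xs : List A) → Unique xs → x ∈ xs → concatMap g xs ↭ t ∷ concatMap f xs
  concatMap-↭-∷ f g off on (a ∷ xs) (a∉ ∷ u) (here refl) =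
    ↭-trans (↭.++⁺ʳ (concatMap g xs) on)
            (prep _ (↭-reflexive (cong (f a ++_) (concatMap-congᴬ g f xs (All.map (λ a≢b → off _ (λ e → a≢b (sym e))) a∉)))))
  concatMap-↭-∷ f g {t = t} off on (a ∷ xs) (a∉ ∷ u) (there x∈) =
    ↭-trans (↭-reflexive (cong (_++ concatMap g xs) (off a (All.lookup a∉ x∈))))
      (↭-trans (↭.++⁺ˡ (f a) (concatMap-↭-∷ f g off on xs u x∈)) (↭.shift t (f a) (concatMap f xs)))

-- Sign characters: monoid homomorphisms σ from (ℕ, +) to {1, -1} ⊆ ℤ.
-- Counting linearizations uses the trivial one, the sign-imbalance uses
-- σ k = (-1)^k; the whole counting argument is run for an arbitrary σ.
module Signs where

  open import Data.Nat as ℕ using (ℕ; zero; suc)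
  import Data.Nat.Properties as ℕ
  open import Data.Integer as ℤ using (ℤ; 1ℤ; _*_; -_)
  import Data.Integer.Properties as ℤ
  open import Relation.Binary.PropositionalEquality
  open import Defs using (parityFromInv)

  record SignCharacter : Set where
    field
      σ : ℕ → ℤ
      σ-+ : ∀ a b → σ (a ℕ.+ b) ≡ σ a * σ b
      σ-square : ∀ a → σ a * σ a ≡ 1ℤ

    σ-0 : σ 0 ≡ 1ℤ
    σ-0 = trans (σ-+ 0 0) (σ-square 0)

    σ-even : ∀ k X → σ (2 ℕ.* k ℕ.* X) ≡ 1ℤ
    σ-even k X = begin
      σ (2 ℕ.* k ℕ.* X)        ≡⟨ cong σ (trans (ℕ.*-assoc 2 k X) (cong (k ℕ.* X ℕ.+_) (ℕ.+-identityʳ (k ℕ.* X)))) ⟩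
      σ (k ℕ.* X ℕ.+ k ℕ.* X)  ≡⟨ σ-+ (k ℕ.* X) (k ℕ.* X) ⟩
      σ (k ℕ.* X) * σ (k ℕ.* X) ≡⟨ σ-square (k ℕ.* X) ⟩
      1ℤ                        ∎
      where
      open ≡-Reasoning

  trivialSign : SignCharacter
  trivialSign = record { σ = λ _ → 1ℤ ; σ-+ = λ _ _ → refl ; σ-square = λ _ → refl }

  paritySign : SignCharacter
  paritySign = record { σ = parityFromInv ; σ-+ = parity-+ ; σ-square = parity-square }
    where
    parity-+ : ∀ a b → parityFromInv (a ℕ.+ b) ≡ parityFromInv a * parityFromInv b
    parity-+ zero b = sym (ℤ.*-identityˡ _)
    parity-+ (suc a) b = trans (cong -_ (parity-+ a b)) (ℤ.neg-distribˡ-* (parityFromInv a) (parityFromInv b))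

    parity-square : ∀ a → parityFromInv a * parityFromInv a ≡ 1ℤ
    parity-square zero = refl
    parity-square (suc a) =
      trans (sym (ℤ.neg-distribˡ-* (parityFromInv a) _))
        (trans (ℤ.neg-distribʳ-* (parityFromInv a) _)
          (trans (cong (parityFromInv a *_) (ℤ.neg-involutive _)) (parity-square a)))

  -- The σ-weighted count of the ways to merge a chain of n new elements into
  -- j free positions: at q = σ 1 this is the Gaussian binomial [n + j, j]_q,
  -- by the q-Pascal rule below.  For the trivial sign it is C(n + j, j).
  interleavings : SignCharacter → ℕ → ℕ → ℤ
  interleavings s zero j = 1ℤ
  interleavings s (suc n) zero = interleavings s n zero
  interleavings s (suc n) (suc j) = interleavings s (suc n) j ℤ.+ SignCharacter.σ s (suc j) * interleavings s n (suc j)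

-- The lexicographic sum seen from the distinguished chain C_{i0}: how an
-- element compares with the new top element (i0 , n) of that chain, in the
-- order of the sum and in the reference order, and the "window" of a
-- linear order (the part after its last element below x_{i0}), which is
-- where the top element can be inserted.
module Lexicographic (m0 : ℕ) (_≼₀_ : Rel (Fin m0) 0ℓ) (po : IsPartialOrder _≡_ _≼₀_)
                     (dec : Decidable _≼₀_) (i0 : Fin m0) where

  open import Data.Nat using (suc; _<ᵇ_; _≡ᵇ_; _<_)
  import Data.Nat.Properties as ℕ
  open import Data.Fin using (toℕ; _≟_)
  import Data.Fin.Properties as Fin
  open import Data.Bool using (Bool; true; false; not; _∧_; _∨_; T; if_then_else_)
  open import Data.Bool.Properties using (∨-identityʳ; ∧-zeroʳ; T-≡; ¬-not)
  open import Data.Empty using (⊥-elim)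
  open import Data.Product using (_,_; proj₁; proj₂)
  open import Data.List using (List; []; _∷_; length; foldr)
  open import Data.List.Relation.Unary.All using (All; []; _∷_)
  open import Function using (Equivalence)
  open import Relation.Binary using (tri<; tri≈; tri>)
  open import Relation.Binary.PropositionalEquality
  open import Relation.Nullary using (does; yes; no; ¬_)
  open import Relation.Nullary.Decidable using (dec-true)
  open import Algebra.Properties.CommutativeSemigroup ℕ.+-commutativeSemigroup using (interchange)
  open import Defs
  open ListFacts using (indicator; count; count-∷)

  open IsPartialOrder po using () renaming (refl to ≼₀-refl; trans to ≼₀-trans; antisym to ≼₀-antisym)

  E : Set
  E = Elt m0

  _≼_ : E → E → Bool
  x ≼ y = _≼ᵇ_ dec x y

  isLin : List E → Bool
  isLin = isLinearizationᵇ dec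

  canPrecede : E → List E → Bool
  canPrecede x xs = foldr (λ y b → not (y ≼ x) ∧ b) true xs

  idx : E → Fin m0
  idx = proj₁

  top : ℕ → E
  top n = (i0 , n)

  below above refBefore refAfter : E → Bool
  below y = does (dec (idx y) i0)
  above y = not (does (idx y ≟ i0)) ∧ does (dec i0 (idx y))
  refBefore y = toℕ (idx y) <ᵇ toℕ i0
  refAfter y = toℕ i0 <ᵇ toℕ (idx y)

  -- the members after y that are smaller than y in the reference order;
  -- counting them in l gives y's contribution to the inversions of y ∷ l
  refSmaller : E → E → Bool
  refSmaller y z = z <refᵇ y

  -- y belongs to the lexicographic sum in which C_{i0} has n elements
  Within : ℕ → E → Set
  Within n y = idx y ≡ i0 → proj₂ y < n

  private
    true-if : ∀ {b} → T b → b ≡ true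
    true-if = Equivalence.to T-≡

    false-if : ∀ {b} → ¬ T b → b ≡ false
    false-if ¬t = ¬-not (λ e → ¬t (Equivalence.from T-≡ e))

    true⇒≼₀ : ∀ {i j} → does (dec i j) ≡ true → i ≼₀ j
    true⇒≼₀ {i} {j} e with dec i j
    ... | yes p = p
    true⇒≼₀ () | no _

  below-top : ∀ n → below (top n) ≡ true
  below-top n = dec-true (dec i0 i0) ≼₀-refl

  ≼-top : ∀ n y → Within n y → y ≼ top n ≡ below y
  ≼-top n (i , j) w with i ≟ i0
  ... | yes refl rewrite dec-true (dec i0 i0) ≼₀-refl = true-if (ℕ.≤⇒≤ᵇ (ℕ.<⇒≤ (w refl)))
  ... | no _ = ∨-identityʳ _

  top-≼ : ∀ n y → Within n y → top n ≼ y ≡ above y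
  top-≼ n (i , j) w with i ≟ i0 | i0 ≟ i
  ... | yes refl | yes _ = false-if (λ t → ℕ.<-irrefl refl (ℕ.<-≤-trans (w refl) (ℕ.≤ᵇ⇒≤ n j t)))
  ... | yes refl | no i0≢i0 = ⊥-elim (i0≢i0 refl)
  ... | no i≢i0 | yes e = ⊥-elim (i≢i0 (sym e))
  ... | no _ | no _ = ∨-identityʳ _

  top-<ref : ∀ n y → Within n y → top n <refᵇ y ≡ refAfter y
  top-<ref n (i , j) w with toℕ i0 ≡ᵇ toℕ i in eq
  ... | false = ∨-identityʳ _
  ... | true with Fin.toℕ-injective (ℕ.≡ᵇ⇒≡ (toℕ i0) (toℕ i) (subst T (sym eq) _))
  ...   | refl = trans (cong ((toℕ i0 <ᵇ toℕ i0) ∨_) (false-if (λ t → ℕ.<-asym (w refl) (ℕ.<ᵇ⇒< n j t))))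
                       (∨-identityʳ _)

  <ref-top : ∀ n y → below y ≡ false → y <refᵇ top n ≡ refBefore y
  <ref-top n (i , j) ¬below with toℕ i ≡ᵇ toℕ i0 in eq
  ... | false = ∨-identityʳ _
  ... | true with Fin.toℕ-injective (ℕ.≡ᵇ⇒≡ (toℕ i) (toℕ i0) (subst T (sym eq) _))
  ...   | refl with () ← trans (sym (below-top j)) ¬below

  below⇒¬above : ∀ y → below y ≡ true → above y ≡ false
  below⇒¬above (i , j) b with i ≟ i0
  ... | yes _ = refl
  ... | no i≢i0 with dec i0 i
  ...   | no _ = refl
  ...   | yes p = ⊥-elim (i≢i0 (≼₀-antisym (true⇒≼₀ b) p))

  below-≼-above : ∀ y z → above y ≡ true → below z ≡ true → z ≼ y ≡ true
  below-≼-above (iy , jy) (iz , jz) a bz with iy ≟ i0 | dec i0 iy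
  below-≼-above (iy , jy) (iz , jz) () bz | yes _ | _
  below-≼-above (iy , jy) (iz , jz) () bz | no _ | no _
  ... | no iy≢i0 | yes p with iz ≟ iy
  ...   | yes refl = ⊥-elim (iy≢i0 (≼₀-antisym (true⇒≼₀ bz) p))
  ...   | no _ rewrite dec-true (dec iz iy) (≼₀-trans (true⇒≼₀ bz) p) = refl

  refBefore+refAfter : ∀ y → below y ≡ false → indicator (refBefore y) ℕ.+ indicator (refAfter y) ≡ 1
  refBefore+refAfter (i , j) ¬below with ℕ.<-cmp (toℕ i) (toℕ i0)
  ... | tri< a _ _ rewrite true-if (ℕ.<⇒<ᵇ a) | false-if (λ t → ℕ.<-asym a (ℕ.<ᵇ⇒< _ _ t)) = refl
  ... | tri> _ _ c rewrite true-if (ℕ.<⇒<ᵇ c) | false-if (λ t → ℕ.<-asym c (ℕ.<ᵇ⇒< _ _ t)) = refl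
  ... | tri≈ _ e _ with Fin.toℕ-injective e
  ...   | refl with () ← trans (sym (below-top j)) ¬below

  anyBelow : List E → Bool
  anyBelow [] = false
  anyBelow (y ∷ l) = below y ∨ anyBelow l

  -- the window of a list: what follows its last element below x_{i0}
  window : List E → List E
  window [] = []
  window (y ∷ l) = if anyBelow l then window l else (if below y then l else y ∷ l)

  freeLength : List E → ℕ
  freeLength [] = 0
  freeLength (y ∷ s) = if above y then 0 else suc (freeLength s)

  restLength : List E → ℕ
  restLength [] = 0
  restLength (y ∷ s) = if above y then length (y ∷ s) else restLength s

  length-free+rest : ∀ s → length s ≡ freeLength s ℕ.+ restLength s
  length-free+rest [] = refl
  length-free+rest (y ∷ s) with above y
  ... | true = refl
  ... | false = cong suc (length-free+rest s)

  canPrecede-top : ∀ n l → All (Within n) l → canPrecede (top n) l ≡ not (anyBelow l)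
  canPrecede-top n [] [] = refl
  canPrecede-top n (y ∷ l) (w ∷ ws) rewrite ≼-top n y w | canPrecede-top n l ws with below y
  ... | true = refl
  ... | false = refl

  above-¬canPrecede : ∀ y l → above y ≡ true → anyBelow l ≡ true → canPrecede y l ≡ false
  above-¬canPrecede y (z ∷ l) a b with below z in ebz
  ... | true rewrite below-≼-above y z a ebz = refl
  ... | false rewrite above-¬canPrecede y l a b = ∧-zeroʳ _

  canPrecede⇒¬above : ∀ y l → canPrecede y l ≡ true → anyBelow l ≡ true → above y ≡ false
  canPrecede⇒¬above y l c b with above y in ea
  ... | false = refl
  ... | true with () ← trans (sym (above-¬canPrecede y l ea b)) c

  window-noBelow : ∀ l → anyBelow l ≡ false → window l ≡ l
  window-noBelow [] _ = refl
  window-noBelow (y ∷ l) e with below y | anyBelow l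
  ... | false | false = refl

  count-refBefore+refAfter : ∀ l → anyBelow l ≡ false → count refBefore l ℕ.+ count refAfter l ≡ length l
  count-refBefore+refAfter [] _ = refl
  count-refBefore+refAfter (y ∷ l) e with below y in eb | anyBelow l in ea
  ... | false | false rewrite count-∷ refBefore y l | count-∷ refAfter y l =
    trans (interchange (indicator (refBefore y)) (count refBefore l) (indicator (refAfter y)) (count refAfter l))
          (cong₂ ℕ._+_ (refBefore+refAfter y eb) (count-refBefore+refAfter l ea))

  count-refSmaller-top : ∀ n l → anyBelow l ≡ false → count (refSmaller (top n)) l ≡ count refBefore l
  count-refSmaller-top n [] _ = refl
  count-refSmaller-top n (y ∷ l) e with below y in eb | anyBelow l in ea
  ... | false | false rewrite count-∷ (refSmaller (top n)) y l | count-∷ refBefore y l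
                            | <ref-top n y eb | count-refSmaller-top n l ea = refl

-- Inserting the new top
-- element t = (i0 , n) of C_{i0} into a linearization l is possible exactly
-- after the last element of l below x_{i0} and before the first element
-- above it, i.e. into an initial segment of the window of l; the window of
-- the result is what follows t.  Summing the weights over all insertions of
-- t therefore gives the weight of l for a new function insertTop K φ.
module Insertion (m0 : ℕ) (_≼₀_ : Rel (Fin m0) 0ℓ) (po : IsPartialOrder _≡_ _≼₀_)
                 (dec : Decidable _≼₀_) (i0 : Fin m0) (sign : Signs.SignCharacter) where

  open Signs using (SignCharacter)

  import Data.Nat.Properties as ℕ
  open import Data.Integer as ℤ using (ℤ; 0ℤ; _+_; _*_)
  import Data.Integer.Properties as ℤ
  open import Data.Bool using (true; false; not; _∧_; _∨_; if_then_else_)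
  open import Data.Bool.Properties using (∧-zeroʳ; ∨-zeroʳ; ∨-conicalʳ)
  open import Data.Product using (_×_; _,_; proj₁; proj₂)
  open import Data.List using (List; []; _∷_; length; map)
  open import Data.List.Relation.Unary.All as All using (All; []; _∷_)
  import Data.List.Relation.Unary.All.Properties as All
  open import Relation.Binary.PropositionalEquality
  open import Data.Integer.Solver using (module +-*-Solver)
  open import Defs
  open ListSums
  open ListFacts using (indicator; count; count-∷; count-insertions)
  open Lexicographic m0 _≼₀_ po dec i0

  open SignCharacter sign
  open +-*-Solver using (solve; _:+_; _:*_; _:=_; con)

  -- the weighted sum over the places where the top element can go into a
  -- window s, before the first element above x_{i0}; φ sees what follows it
  -- and σ sees the inversions the top element creates, up to the offset K
  insertTop : ℕ → (List E → ℤ) → List E → ℤ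
  insertTop K φ [] = σ (K ℕ.+ 0) * φ []
  insertTop K φ (y ∷ s) = σ (K ℕ.+ length (y ∷ s)) * φ (y ∷ s) + (if above y then 0ℤ else insertTop K φ s)

  weight : (List E → ℤ) → List E → ℤ
  weight φ l = if isLin l then σ (inversions l) * φ (window l) else 0ℤ

  insertTop-shift : ∀ a K φ s → insertTop (a ℕ.+ K) φ s ≡ σ a * insertTop K φ s
  insertTop-shift a K φ [] rewrite ℕ.+-assoc a K 0 | σ-+ a (K ℕ.+ 0) = ℤ.*-assoc (σ a) _ _
  insertTop-shift a K φ (y ∷ s) rewrite ℕ.+-assoc a K (length (y ∷ s)) | σ-+ a (K ℕ.+ length (y ∷ s)) with above y
  ... | true = trans (ℤ.+-identityʳ _) (trans (ℤ.*-assoc (σ a) _ _) (cong (σ a *_) (sym (ℤ.+-identityʳ _))))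
  ... | false rewrite insertTop-shift a K φ s = trans (cong (_+ σ a * insertTop K φ s) (ℤ.*-assoc (σ a) _ _))
                                                        (sym (ℤ.*-distribˡ-+ (σ a) _ _))

  insertTop-cong : ∀ K (φ ψ : List E → ℤ) → (∀ v → φ v ≡ ψ v) → ∀ s → insertTop K φ s ≡ insertTop K ψ s
  insertTop-cong K φ ψ e [] = cong (σ (K ℕ.+ 0) *_) (e [])
  insertTop-cong K φ ψ e (y ∷ s) =
    cong₂ _+_ (cong (σ (K ℕ.+ length (y ∷ s)) *_) (e (y ∷ s)))
              (cong (λ x → if above y then 0ℤ else x) (insertTop-cong K φ ψ e s))

  weight-false : ∀ φ l → isLin l ≡ false → weight φ l ≡ 0ℤ
  weight-false φ l e = cong (λ b → if b then σ (inversions l) * φ (window l) else 0ℤ) e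

  weight-true : ∀ φ l → isLin l ≡ true → weight φ l ≡ σ (inversions l) * φ (window l)
  weight-true φ l e = cong (λ b → if b then σ (inversions l) * φ (window l) else 0ℤ) e

  -- the factor by which putting y in front multiplies the weight, when what
  -- follows y contains an element below x_{i0}
  frontFactor : E → List E → ℤ
  frontFactor y l = if not (above y) ∧ canPrecede y l then σ (indicator (refAfter y) ℕ.+ count (refSmaller y) l) else 0ℤ

  private
    if-∧-* : ∀ a b x y (z : ℤ) →
             (if a ∧ b then σ (x ℕ.+ y) * z else 0ℤ) ≡ (if a then σ x else 0ℤ) * (if b then σ y * z else 0ℤ)
    if-∧-* true true x y z rewrite σ-+ x y = ℤ.*-assoc (σ x) (σ y) z
    if-∧-* true false x y z = sym (ℤ.*-zeroʳ (σ x))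
    if-∧-* false b x y z = refl

  weight-front : ∀ φ y l k →
    canPrecede y k ≡ (not (above y) ∧ canPrecede y l) →
    count (refSmaller y) k ≡ indicator (refAfter y) ℕ.+ count (refSmaller y) l →
    anyBelow k ≡ true →
    weight φ (y ∷ k) ≡ frontFactor y l * weight φ k
  weight-front φ y l k e-prec e-count e-below =
    trans (cong₃ (λ a c b → if a ∧ isLin k then σ (c ℕ.+ inversions k)
                              * φ (if b then window k else (if below y then k else y ∷ k)) else 0ℤ)
                 e-prec e-count e-below)
          (if-∧-* (not (above y) ∧ canPrecede y l) (isLin k)
                  (indicator (refAfter y) ℕ.+ count (refSmaller y) l) (inversions k) (φ (window k)))
    where
    cong₃ : ∀ {A B C D : Set} (f : A → B → C → D) {a a' b b' c c'} → a ≡ a' → b ≡ b' → c ≡ c' → f a b c ≡ f a' b' c'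
    cong₃ f refl refl refl = refl

  module _ (n : ℕ) where

    canPrecede-insertions : ∀ y l → All (λ k → canPrecede y k ≡ (not (top n ≼ y) ∧ canPrecede y l)) (insertions (top n) l)
    canPrecede-insertions y [] = refl ∷ []
    canPrecede-insertions y (z ∷ l) =
      refl ∷ All.map⁺ (All.map (λ e → trans (cong (not (z ≼ y) ∧_) e) (∧-swap (not (z ≼ y)) (not (top n ≼ y)) _))
                               (canPrecede-insertions y l))
      where
      ∧-swap : ∀ a b c → a ∧ (b ∧ c) ≡ b ∧ (a ∧ c)
      ∧-swap true b c = refl
      ∧-swap false true c = refl
      ∧-swap false false c = refl

    anyBelow-insertions : ∀ l → All (λ k → anyBelow k ≡ true) (insertions (top n) l)
    anyBelow-insertions [] = cong (_∨ false) (below-top n) ∷ []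
    anyBelow-insertions (z ∷ l) =
      cong (_∨ (below z ∨ anyBelow l)) (below-top n) ∷ All.map⁺ (All.map (λ e → trans (cong (below z ∨_) e) (∨-zeroʳ (below z)))
                                                     (anyBelow-insertions l))

    module Step (φ : List E → ℤ) (y : E) (l : List E) where
      t : E
      t = top n
      K A : ℕ
      K = count refAfter l
      A = count (refSmaller y) l ℕ.+ inversions l

      stepLHS stepRHS : ℤ
      stepLHS = weight φ (t ∷ y ∷ l) + frontFactor y l * weight (insertTop K φ) l
      stepRHS = weight (insertTop (count refAfter (y ∷ l)) φ) (y ∷ l)

      insertTop-y : ∀ s → insertTop (count refAfter (y ∷ l)) φ s ≡ σ (indicator (refAfter y)) * insertTop K φ s
      insertTop-y s = trans (cong (λ k → insertTop k φ s) (count-∷ refAfter y l)) (insertTop-shift _ K φ s)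

      step-nonlinear : isLin (y ∷ l) ≡ false → stepLHS ≡ stepRHS
      step-nonlinear e =
        trans (cong₂ _+_ (weight-false φ (t ∷ y ∷ l) (trans (cong (canPrecede t (y ∷ l) ∧_) e) (∧-zeroʳ _)))
                         (second (canPrecede y l) (isLin l) refl refl e))
              (sym (weight-false (insertTop (count refAfter (y ∷ l)) φ) (y ∷ l) e))
        where
        second : ∀ p q → canPrecede y l ≡ p → isLin l ≡ q → p ∧ q ≡ false →
                 frontFactor y l * weight (insertTop K φ) l ≡ 0ℤ
        second false q ep eq _ = trans (cong (λ b → (if not (above y) ∧ b then σ' else 0ℤ) * W) ep)
                                       (cong (λ b → (if b then σ' else 0ℤ) * W) (∧-zeroʳ (not (above y))))
          where
          σ' W : ℤ
          σ' = σ (indicator (refAfter y) ℕ.+ count (refSmaller y) l)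
          W = weight (insertTop K φ) l
        second true false ep eq _ = trans (cong (frontFactor y l *_) (weight-false (insertTop K φ) l eq)) (ℤ.*-zeroʳ (frontFactor y l))

      K⁺ : ℕ
      K⁺ = count refAfter (y ∷ l)

      stepRHS-linear : canPrecede y l ≡ true → isLin l ≡ true → stepRHS ≡ σ A * insertTop K⁺ φ (window (y ∷ l))
      stepRHS-linear ep el = weight-true (insertTop K⁺ φ) (y ∷ l) (cong₂ _∧_ ep el)

      -- when y is not above x_{i0}, the second summand is the part of the
      -- right-hand side where t comes after y
      front-term : canPrecede y l ≡ true → isLin l ≡ true → above y ≡ false →
                   frontFactor y l * weight (insertTop K φ) l ≡ σ A * insertTop K⁺ φ (window l)
      front-term ep el ea =
        begin
          frontFactor y l * weight (insertTop K φ) l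
        ≡⟨ cong₂ _*_ (cong₂ (λ a b → if not a ∧ b then σ (g ℕ.+ c) else 0ℤ) ea ep) (weight-true (insertTop K φ) l el) ⟩
          σ (g ℕ.+ c) * (σ (inversions l) * insertTop K φ (window l))
        ≡⟨ cong (λ x → x * (σ (inversions l) * insertTop K φ (window l))) (σ-+ g c) ⟩
          σ g * σ c * (σ (inversions l) * insertTop K φ (window l))
        ≡⟨ solve 4 (λ a b c d → a :* b :* (c :* d) := b :* c :* (a :* d)) refl
                   (σ g) (σ c) (σ (inversions l)) (insertTop K φ (window l)) ⟩
          σ c * σ (inversions l) * (σ g * insertTop K φ (window l))
        ≡⟨ cong₂ _*_ (sym (σ-+ c (inversions l))) (sym (insertTop-y (window l))) ⟩
          σ A * insertTop K⁺ φ (window l)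
        ∎
        where
        open ≡-Reasoning
        g c : ℕ
        g = indicator (refAfter y)
        c = count (refSmaller y) l

      -- t cannot come first when y ∷ l has an element below x_{i0}
      step-belowAfter : All (Within n) (y ∷ l) → canPrecede y l ≡ true → isLin l ≡ true →
                        anyBelow (y ∷ l) ≡ true → stepLHS ≡ stepRHS
      step-belowAfter ws ep el eb =
        begin
          weight φ (t ∷ y ∷ l) + frontFactor y l * weight (insertTop K φ) l
        ≡⟨ cong (_+ frontFactor y l * weight (insertTop K φ) l) (weight-false φ (t ∷ y ∷ l) t-late) ⟩
          0ℤ + frontFactor y l * weight (insertTop K φ) l
        ≡⟨ ℤ.+-identityˡ _ ⟩
          frontFactor y l * weight (insertTop K φ) l
        ≡⟨ front-term ep el (proj₁ y-shape) ⟩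
          σ A * insertTop K⁺ φ (window l)
        ≡⟨ cong (λ s → σ A * insertTop K⁺ φ s) (sym (proj₂ y-shape)) ⟩
          σ A * insertTop K⁺ φ (window (y ∷ l))
        ≡⟨ sym (stepRHS-linear ep el) ⟩
          stepRHS
        ∎
        where
        open ≡-Reasoning
        t-late : isLin (t ∷ y ∷ l) ≡ false
        t-late = cong (_∧ isLin (y ∷ l)) (trans (canPrecede-top n (y ∷ l) ws) (cong not eb))
        shape : ∀ a b → anyBelow l ≡ a → below y ≡ b → above y ≡ false × window (y ∷ l) ≡ window l
        shape true _ ea _ = canPrecede⇒¬above y l ep ea , cong (λ a → if a then window l else (if below y then l else y ∷ l)) ea
        shape false true ea eby =
          below⇒¬above y eby , trans (cong₂ (λ a b → if a then window l else (if b then l else y ∷ l)) ea eby)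
                                     (sym (window-noBelow l ea))
        shape false false ea eby with () ← trans (sym (cong₂ _∨_ eby ea)) eb
        y-shape : above y ≡ false × window (y ∷ l) ≡ window l
        y-shape = shape (anyBelow l) (below y) refl refl

      σ-top-inversions : anyBelow (y ∷ l) ≡ false →
                         σ (count (refSmaller t) (y ∷ l)) ≡ σ (K⁺ ℕ.+ length (y ∷ l))
      σ-top-inversions e =
        begin
          σ (count (refSmaller t) (y ∷ l))
        ≡⟨ cong σ (count-refSmaller-top n (y ∷ l) e) ⟩
          σ b
        ≡⟨ sym (trans (cong (_* σ b) (σ-square K⁺)) (ℤ.*-identityˡ (σ b))) ⟩
          σ K⁺ * σ K⁺ * σ b
        ≡⟨ trans (ℤ.*-assoc (σ K⁺) _ _)
                 (cong (σ K⁺ *_) (trans (ℤ.*-comm (σ K⁺) (σ b)) (sym (σ-+ b K⁺)))) ⟩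
          σ K⁺ * σ (b ℕ.+ K⁺)
        ≡⟨ sym (trans (cong σ (cong (K⁺ ℕ.+_) (sym (count-refBefore+refAfter (y ∷ l) e)))) (σ-+ K⁺ (b ℕ.+ K⁺))) ⟩
          σ (K⁺ ℕ.+ length (y ∷ l))
        ∎
        where
        open ≡-Reasoning
        b : ℕ
        b = count refBefore (y ∷ l)

      -- t can come first: it sits before the whole window y ∷ l
      step-window : All (Within n) (y ∷ l) → canPrecede y l ≡ true → isLin l ≡ true →
                    anyBelow (y ∷ l) ≡ false → stepLHS ≡ stepRHS
      step-window ws ep el eb =
        begin
          weight φ (t ∷ y ∷ l) + frontFactor y l * weight (insertTop K φ) l
        ≡⟨ cong₂ _+_ (weight-true φ (t ∷ y ∷ l) t-first) (rest (above y) refl) ⟩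
          σ (count (refSmaller t) (y ∷ l) ℕ.+ A) * φ (window (t ∷ y ∷ l)) + σ A * R
        ≡⟨ cong₂ (λ x s → σ x * φ s + σ A * R) (ℕ.+-comm (count (refSmaller t) (y ∷ l)) A) t-window ⟩
          σ (A ℕ.+ count (refSmaller t) (y ∷ l)) * φ (y ∷ l) + σ A * R
        ≡⟨ cong (λ x → x * φ (y ∷ l) + σ A * R) (trans (σ-+ A _) (cong (σ A *_) (σ-top-inversions eb))) ⟩
          σ A * σ (K⁺ ℕ.+ length (y ∷ l)) * φ (y ∷ l) + σ A * R
        ≡⟨ trans (cong (_+ σ A * R) (ℤ.*-assoc (σ A) _ _)) (sym (ℤ.*-distribˡ-+ (σ A) _ R)) ⟩
          σ A * insertTop K⁺ φ (y ∷ l)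
        ≡⟨ cong (λ s → σ A * insertTop K⁺ φ s) (sym (window-noBelow (y ∷ l) eb)) ⟩
          σ A * insertTop K⁺ φ (window (y ∷ l))
        ≡⟨ sym (stepRHS-linear ep el) ⟩
          stepRHS
        ∎
        where
        open ≡-Reasoning
        R : ℤ
        R = if above y then 0ℤ else insertTop K⁺ φ l
        t-first : isLin (t ∷ y ∷ l) ≡ true
        t-first = cong₂ _∧_ (trans (canPrecede-top n (y ∷ l) ws) (cong not eb)) (cong₂ _∧_ ep el)
        t-window : window (t ∷ y ∷ l) ≡ y ∷ l
        t-window = trans (cong (λ b → if b then window (y ∷ l) else (if below t then y ∷ l else t ∷ y ∷ l)) eb)
                         (cong (λ b → if b then y ∷ l else t ∷ y ∷ l) (below-top n))
        l-window : window l ≡ l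
        l-window = window-noBelow l (∨-conicalʳ (below y) (anyBelow l) eb)
        rest : ∀ a → above y ≡ a → frontFactor y l * weight (insertTop K φ) l ≡ σ A * R
        rest false ea = trans (front-term ep el ea)
                              (cong₂ (λ s b → σ A * (if b then 0ℤ else insertTop K⁺ φ s)) l-window (sym ea))
        rest true ea =
          trans (cong (_* weight (insertTop K φ) l)
                      (cong (λ a → if not a ∧ canPrecede y l then σ (indicator (refAfter y) ℕ.+ count (refSmaller y) l) else 0ℤ) ea))
                (trans (sym (ℤ.*-zeroʳ (σ A))) (cong (λ b → σ A * (if b then 0ℤ else insertTop K⁺ φ l)) (sym ea)))

      insertion-step : All (Within n) (y ∷ l) → stepLHS ≡ stepRHS
      insertion-step ws = cases (canPrecede y l) (isLin l) (anyBelow (y ∷ l)) refl refl refl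
        where
        cases : ∀ p q b → canPrecede y l ≡ p → isLin l ≡ q → anyBelow (y ∷ l) ≡ b → stepLHS ≡ stepRHS
        cases false _ _ ep _ _ = step-nonlinear (cong (_∧ isLin l) ep)
        cases true false _ _ el _ = step-nonlinear (trans (cong (canPrecede y l ∧_) el) (∧-zeroʳ _))
        cases true true true ep el eb = step-belowAfter ws ep el eb
        cases true true false ep el eb = step-window ws ep el eb

    sum-insertions : ∀ φ l → All (Within n) l →
                     sumℤ (weight φ) (insertions (top n) l) ≡ weight (insertTop (count refAfter l) φ) l
    sum-insertions φ [] [] =
      trans (ℤ.+-identityʳ _)
        (trans (cong (λ b → σ 0 * φ (if b then [] else top n ∷ [])) (below-top n))
               (cong (σ 0 *_) (sym (trans (cong (_* φ []) σ-0) (ℤ.*-identityˡ _)))))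
    sum-insertions φ (y ∷ l) (w ∷ ws) =
      trans (cong (weight φ (top n ∷ y ∷ l) +_) after-y) (Step.insertion-step φ y l (w ∷ ws))
      where
      front : All (λ k → weight φ (y ∷ k) ≡ frontFactor y l * weight φ k) (insertions (top n) l)
      front = All.zipWith (λ {k} → at-front {k}) (canPrecede-insertions y l ,
                                    All.zipWith (λ p → p) (count-insertions (refSmaller y) (top n) l , anyBelow-insertions l))
        where
        at-front : ∀ {k} → canPrecede y k ≡ (not (top n ≼ y) ∧ canPrecede y l) ×
                           (count (refSmaller y) k ≡ indicator (top n <refᵇ y) ℕ.+ count (refSmaller y) l ×
                            anyBelow k ≡ true) →
                   weight φ (y ∷ k) ≡ frontFactor y l * weight φ k
        at-front {k} (e₁ , e₂ , e₃) =
          weight-front φ y l k (trans e₁ (cong (λ u → not u ∧ canPrecede y l) (top-≼ n y w)))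
                                 (trans e₂ (cong (λ u → indicator u ℕ.+ count (refSmaller y) l) (top-<ref n y w))) e₃
      after-y : sumℤ (weight φ) (map (y ∷_) (insertions (top n) l))
                ≡ frontFactor y l * weight (insertTop (count refAfter l) φ) l
      after-y = trans (sumℤ-map (weight φ) (y ∷_) (insertions (top n) l))
                  (trans (sumℤ-congᴬ (insertions (top n) l) front)
                    (trans (sumℤ-scale (frontFactor y l) (weight φ) (insertions (top n) l))
                           (cong (frontFactor y l *_) (sum-insertions φ l ws))))

-- Since
-- the sum of a function over all permutations depends only on the list up
-- to reordering, iterating the insertion lemma expresses the weighted sum
-- over the linearizations for m_{i0} = n through those for m_{i0} = 0.
module Growth (m0 : ℕ) (_≼₀_ : Rel (Fin m0) 0ℓ) (po : IsPartialOrder _≡_ _≼₀_)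
              (dec : Decidable _≼₀_) (i0 : Fin m0) (m : Fin m0 → ℕ) where

  open import Data.Nat using (zero; suc; _<ᵇ_)
  import Data.Nat.Properties as ℕ
  open import Data.Integer using (ℤ)
  open import Data.Fin using (toℕ; _≟_)
  open import Data.Bool using (false; T; if_then_else_)
  open import Data.Bool.Properties using (¬-not)
  open import Data.Product using (_,_)
  open import Data.List using (List; []; _∷_; map; upTo; allFin; _∷ʳ_)
  open import Data.List.Properties using (upTo-∷ʳ; map-++)
  open import Data.List.Relation.Unary.All as All using (All)
  import Data.List.Relation.Unary.All.Properties as All
  open import Data.List.Membership.Propositional.Properties using (∈-allFin)
  open import Data.List.Relation.Unary.Unique.Propositional.Properties using (allFin⁺)
  open import Data.List.Relation.Binary.Permutation.Propositional using (_↭_; ↭-trans; ↭-sym; ↭-reflexive)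
  import Data.List.Relation.Binary.Permutation.Propositional.Properties as ↭
  open import Relation.Binary.PropositionalEquality
  open import Relation.Nullary using (¬_)
  open import Relation.Nullary.Decidable using (dec-true; dec-false)
  open import Defs
  open ListSums using (sumℤ; sumℤ-permutations-↭; sumℤ-permutations-∷; sumℤ-congᴬ)
  open ListFacts
  open Signs using (SignCharacter)
  open Lexicographic m0 _≼₀_ po dec i0

  block : (Fin m0 → ℕ) → Fin m0 → List E
  block mm i = map (i ,_) (upTo (mm i))

  update-i0 : ∀ n → update m i0 n i0 ≡ n
  update-i0 n = cong (λ b → if b then n else m i0) (dec-true (i0 ≟ i0) refl)

  update-off : ∀ n i → ¬ i ≡ i0 → update m i0 n i ≡ m i
  update-off n i i≢i0 = cong (λ b → if b then n else m i) (dec-false (i ≟ i0) i≢i0)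

  Eₙ : ℕ → List E
  Eₙ n = elements (update m i0 n)

  Eₙ-grow : ∀ n → Eₙ (suc n) ↭ top n ∷ Eₙ n
  Eₙ-grow n = concatMap-↭-∷ (block (update m i0 n)) (block (update m i0 (suc n)))
                (λ i i≢i0 → cong (λ k → map (i ,_) (upTo k)) (trans (update-off (suc n) i i≢i0) (sym (update-off n i i≢i0))))
                chain-grows (allFin m0) (allFin⁺ m0) (∈-allFin i0)
    where
    chain-grows : block (update m i0 (suc n)) i0 ↭ top n ∷ block (update m i0 n) i0
    chain-grows =
      ↭-trans (↭-reflexive (trans (cong (λ k → map (i0 ,_) (upTo k)) (update-i0 (suc n)))
                           (trans (cong (map (i0 ,_)) (sym (upTo-∷ʳ n)))
                                  (trans (map-++ (i0 ,_) (upTo n) (n ∷ []))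
                                         (cong (λ k → map (i0 ,_) (upTo k) ∷ʳ top n) (sym (update-i0 n)))))))
              (↭-sym (↭.∷↭∷ʳ (top n) _))

  Eₙ-Within : ∀ n → All (Within n) (Eₙ n)
  Eₙ-Within n = All.concat⁺ (All.map⁺ (All.universal (λ i → All.map⁺ (All.applyUpTo⁺₁ (λ j → j) (update m i0 n i)
                  (λ {j} j< e → subst (j ℕ.<_) (trans (cong (update m i0 n) e) (update-i0 n)) j<))) (allFin m0)))

  K : ℕ
  K = count refAfter (Eₙ 0)

  count-refAfter-Eₙ : ∀ n → count refAfter (Eₙ n) ≡ K
  count-refAfter-Eₙ zero = refl
  count-refAfter-Eₙ (suc n) =
    trans (count-↭ refAfter (Eₙ-grow n))
      (trans (count-∷ refAfter (top n) (Eₙ n))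
        (trans (cong (λ b → indicator b ℕ.+ count refAfter (Eₙ n)) top-not-refAfter) (count-refAfter-Eₙ n)))
    where
    top-not-refAfter : refAfter (top n) ≡ false
    top-not-refAfter = ¬-not (λ e → ℕ.<-irrefl refl (ℕ.<ᵇ⇒< (toℕ i0) (toℕ i0) (subst T (sym e) _)))

  module Iteration (sign : SignCharacter) where

    open Insertion m0 _≼₀_ po dec i0 sign

    insertTop^ : ℕ → (List E → ℤ) → List E → ℤ
    insertTop^ zero φ = φ
    insertTop^ (suc n) φ = insertTop^ n (insertTop K φ)

    sum-weights-Eₙ : ∀ n φ → sumℤ (weight φ) (permutations (Eₙ n)) ≡ sumℤ (weight (insertTop^ n φ)) (permutations (Eₙ 0))
    sum-weights-Eₙ zero φ = refl
    sum-weights-Eₙ (suc n) φ =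
      trans (sumℤ-permutations-↭ (Eₙ-grow n) (weight φ))
        (trans (sumℤ-permutations-∷ (weight φ) (top n) (Eₙ n))
          (trans (sumℤ-congᴬ (permutations (Eₙ n)) insert-each) (sum-weights-Eₙ n (insertTop K φ))))
      where
      insert-each : All (λ l → sumℤ (weight φ) (Defs.insertions (top n) l) ≡ weight (insertTop K φ) l) (permutations (Eₙ n))
      insert-each = All.zipWith (λ {l} (w , c) → trans (sum-insertions n φ l w)
                                                   (cong (λ k → weight (insertTop k φ) l) (trans c (count-refAfter-Eₙ n))))
                                (permutations-All (Eₙ n) (Eₙ-Within n) , count-permutations refAfter (Eₙ n))

-- Evaluating the iterated insertion operator on the constant function 1.
-- In a window s the top elements can only fill the free prefix before the
-- first element above x_{i0}; n of them can do so in interleavings σ n j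
-- weighted ways, j being the length of that prefix.
module ClosedForm (m0 : ℕ) (_≼₀_ : Rel (Fin m0) 0ℓ) (po : IsPartialOrder _≡_ _≼₀_)
                  (dec : Decidable _≼₀_) (i0 : Fin m0) (m : Fin m0 → ℕ) (sign : Signs.SignCharacter) where

  open Signs using (SignCharacter)

  open import Data.Nat using (zero; suc)
  import Data.Nat.Properties as ℕ
  open import Data.Integer as ℤ using (ℤ; 0ℤ; 1ℤ; _+_; _*_)
  import Data.Integer.Properties as ℤ
  open import Data.Bool using (true; false; if_then_else_)
  open import Data.List using (List; []; _∷_; length)
  open import Relation.Binary.PropositionalEquality
  open import Data.Integer.Solver using (module +-*-Solver)
  open Lexicographic m0 _≼₀_ po dec i0
  open Growth m0 _≼₀_ po dec i0 m
  open Iteration sign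
  open Insertion m0 _≼₀_ po dec i0 sign
  open Signs using (interleavings)

  open SignCharacter sign
  open +-*-Solver using (solve; _:+_; _:*_; _:=_)

  insertTop^-suc : ∀ n (φ : List E → ℤ) s → insertTop^ (suc n) φ s ≡ insertTop K (insertTop^ n φ) s
  insertTop^-suc zero φ s = refl
  insertTop^-suc (suc n) φ s = insertTop^-suc n (insertTop K φ) s

  -- the closed form of insertTop^ n 1: the top elements interleave with the
  -- free prefix, and each of them carries the sign σ (K + restLength s)
  closedForm : ℕ → List E → ℤ
  closedForm n s = σ (n ℕ.* (K ℕ.+ restLength s)) * interleavings sign n (freeLength s)

  private
    g : ℕ → ℕ → ℤ
    g = interleavings sign

  -- the top elements cannot pass an element above x_{i0}
  closedForm-above : ∀ n y s → above y ≡ true → insertTop K (closedForm n) (y ∷ s) ≡ closedForm (suc n) (y ∷ s)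
  closedForm-above n y s ea =
    begin
      σ (K ℕ.+ L) * (σ (n ℕ.* (K ℕ.+ restLength (y ∷ s))) * g n (freeLength (y ∷ s)))
        + (if above y then 0ℤ else insertTop K (closedForm n) s)
    ≡⟨ cong₂ _+_ (cong₂ (λ r j → σ (K ℕ.+ L) * (σ (n ℕ.* (K ℕ.+ r)) * g n j)) e-rest e-free)
                 (cong (λ a → if a then 0ℤ else insertTop K (closedForm n) s) ea) ⟩
      σ (K ℕ.+ L) * (σ (n ℕ.* (K ℕ.+ L)) * g n 0) + 0ℤ
    ≡⟨ trans (ℤ.+-identityʳ _) (trans (sym (ℤ.*-assoc (σ (K ℕ.+ L)) _ _)) (cong (_* g n 0) (sym (σ-+ (K ℕ.+ L) _)))) ⟩
      σ (suc n ℕ.* (K ℕ.+ L)) * g (suc n) 0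
    ≡⟨ sym (cong₂ (λ r j → σ (suc n ℕ.* (K ℕ.+ r)) * g (suc n) j) e-rest e-free) ⟩
      closedForm (suc n) (y ∷ s)
    ∎
    where
    open ≡-Reasoning
    L : ℕ
    L = length (y ∷ s)
    e-rest : restLength (y ∷ s) ≡ L
    e-rest = cong (λ a → if a then L else restLength s) ea
    e-free : freeLength (y ∷ s) ≡ 0
    e-free = cong (λ a → if a then 0 else suc (freeLength s)) ea

  -- in front of a free element, the first top element either stops before
  -- it or passes it: the q-Pascal rule for interleavings
  closedForm-free : ∀ n y s → above y ≡ false → insertTop K (closedForm n) s ≡ closedForm (suc n) s →
                    insertTop K (closedForm n) (y ∷ s) ≡ closedForm (suc n) (y ∷ s)
  closedForm-free n y s ea rest =
    begin
      σ (K ℕ.+ L) * (σ (n ℕ.* (K ℕ.+ restLength (y ∷ s))) * g n (freeLength (y ∷ s)))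
        + (if above y then 0ℤ else insertTop K (closedForm n) s)
    ≡⟨ cong₂ _+_ (cong₂ (λ r j → σ (K ℕ.+ L) * (σ (n ℕ.* (K ℕ.+ r)) * g n j)) e-rest e-free)
                 (cong (λ a → if a then 0ℤ else insertTop K (closedForm n) s) ea) ⟩
      σ (K ℕ.+ L) * (σ (n ℕ.* (K ℕ.+ ρ)) * g n (suc j)) + insertTop K (closedForm n) s
    ≡⟨ cong₂ _+_ (cong (λ x → σ x * (σ (n ℕ.* (K ℕ.+ ρ)) * g n (suc j))) e-length) rest ⟩
      σ ((K ℕ.+ ρ) ℕ.+ suc j) * (σ (n ℕ.* (K ℕ.+ ρ)) * g n (suc j)) + σ (suc n ℕ.* (K ℕ.+ ρ)) * g (suc n) j
    ≡⟨ cong₂ (λ a b → a * (σ (n ℕ.* (K ℕ.+ ρ)) * g n (suc j)) + b * g (suc n) j)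
             (σ-+ (K ℕ.+ ρ) (suc j)) (σ-+ (K ℕ.+ ρ) (n ℕ.* (K ℕ.+ ρ))) ⟩
      σ (K ℕ.+ ρ) * σ (suc j) * (σ (n ℕ.* (K ℕ.+ ρ)) * g n (suc j)) + σ (K ℕ.+ ρ) * σ (n ℕ.* (K ℕ.+ ρ)) * g (suc n) j
    ≡⟨ solve 5 (λ a b c d e → a :* b :* (c :* d) :+ a :* c :* e := a :* c :* (e :+ b :* d)) refl
         (σ (K ℕ.+ ρ)) (σ (suc j)) (σ (n ℕ.* (K ℕ.+ ρ))) (g n (suc j)) (g (suc n) j) ⟩
      σ (K ℕ.+ ρ) * σ (n ℕ.* (K ℕ.+ ρ)) * g (suc n) (suc j)
    ≡⟨ cong (_* g (suc n) (suc j)) (sym (σ-+ (K ℕ.+ ρ) (n ℕ.* (K ℕ.+ ρ)))) ⟩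
      σ (suc n ℕ.* (K ℕ.+ ρ)) * g (suc n) (suc j)
    ≡⟨ sym (cong₂ (λ r j → σ (suc n ℕ.* (K ℕ.+ r)) * g (suc n) j) e-rest e-free) ⟩
      closedForm (suc n) (y ∷ s)
    ∎
    where
    open ≡-Reasoning
    L j ρ : ℕ
    L = length (y ∷ s)
    j = freeLength s
    ρ = restLength s
    e-rest : restLength (y ∷ s) ≡ ρ
    e-rest = cong (λ a → if a then L else restLength s) ea
    e-free : freeLength (y ∷ s) ≡ suc j
    e-free = cong (λ a → if a then 0 else suc (freeLength s)) ea
    e-length : K ℕ.+ L ≡ (K ℕ.+ ρ) ℕ.+ suc j
    e-length = trans (cong (λ x → K ℕ.+ suc x) (length-free+rest s))
                 (trans (cong (K ℕ.+_) (trans (cong suc (ℕ.+-comm j ρ)) (sym (ℕ.+-suc ρ j)))) (sym (ℕ.+-assoc K ρ (suc j))))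

  insertTop-closedForm : ∀ n s → insertTop K (closedForm n) s ≡ closedForm (suc n) s
  insertTop-closedForm n [] rewrite σ-+ (K ℕ.+ 0) (n ℕ.* (K ℕ.+ 0)) = sym (ℤ.*-assoc (σ (K ℕ.+ 0)) _ _)
  insertTop-closedForm n (y ∷ s) = by-above (above y) refl
    where
    by-above : ∀ a → above y ≡ a → insertTop K (closedForm n) (y ∷ s) ≡ closedForm (suc n) (y ∷ s)
    by-above true ea = closedForm-above n y s ea
    by-above false ea = closedForm-free n y s ea (insertTop-closedForm n s)

  insertTop^-one : ∀ n s → insertTop^ n (λ _ → 1ℤ) s ≡ closedForm n s
  insertTop^-one zero s = sym (trans (cong (_* 1ℤ) σ-0) refl)
  insertTop^-one (suc n) s =
    trans (insertTop^-suc n (λ _ → 1ℤ) s)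
      (trans (insertTop-cong K _ _ (insertTop^-one n) s) (insertTop-closedForm n s))

module Rationals where

  open import Data.Nat as ℕ using (ℕ; suc)
  open import Data.Integer as ℤ using (ℤ; +_; 0ℤ; 1ℤ)
  import Data.Integer.Properties as ℤ
  open import Data.Rational as ℚ using (ℚ; mkℚ; 0ℚ; 1ℚ; _+_; _*_; 1/_; ↥_)
  import Data.Rational.Properties as ℚ
  import Data.Rational.Unnormalised as ℚᵘ
  import Data.Rational.Unnormalised.Properties as ℚᵘ
  open import Data.Nat.Coprimality as Coprime using (1-coprimeTo)
  open import Data.List using (List; []; _∷_)
  open import Relation.Binary.PropositionalEquality
  open import Relation.Nullary using (¬_)
  open import Data.Integer.Solver using (module +-*-Solver)
  open import Defs using (ℕtoℚ; ℤtoℚ)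
  open ListSums using (sumℤ)

  open +-*-Solver using (solve; _:+_; _:*_; _:=_; con)

  private
    ℤtoℚ-normal : ∀ z → ℤtoℚ z ≡ mkℚ z 0 (Coprime.sym (1-coprimeTo ℤ.∣ z ∣))
    ℤtoℚ-normal z = ℚ.↥p/↧p≡p (mkℚ z 0 (Coprime.sym (1-coprimeTo ℤ.∣ z ∣)))

    toℚᵘ-ℤtoℚ : ∀ z → ℚ.toℚᵘ (ℤtoℚ z) ≡ ℚᵘ.mkℚᵘ z 0
    toℚᵘ-ℤtoℚ z = cong ℚ.toℚᵘ (ℤtoℚ-normal z)

  ℤtoℚ-+ : ∀ a b → ℤtoℚ (a ℤ.+ b) ≡ ℤtoℚ a + ℤtoℚ b
  ℤtoℚ-+ a b = ℚ.toℚᵘ-injective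
    (ℚᵘ.≃-trans (ℚᵘ.≃-reflexive (toℚᵘ-ℤtoℚ (a ℤ.+ b)))
     (ℚᵘ.≃-trans (ℚᵘ.*≡* (solve 2 (λ a b → (a :+ b) :* con 1ℤ := (a :* con 1ℤ :+ b :* con 1ℤ) :* con 1ℤ) refl a b))
      (ℚᵘ.≃-trans (ℚᵘ.≃-reflexive (sym (cong₂ ℚᵘ._+_ (toℚᵘ-ℤtoℚ a) (toℚᵘ-ℤtoℚ b))))
        (ℚᵘ.≃-sym (ℚ.toℚᵘ-homo-+ (ℤtoℚ a) (ℤtoℚ b))))))

  ℤtoℚ-* : ∀ a b → ℤtoℚ (a ℤ.* b) ≡ ℤtoℚ a * ℤtoℚ b
  ℤtoℚ-* a b = ℚ.toℚᵘ-injective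
    (ℚᵘ.≃-trans (ℚᵘ.≃-reflexive (toℚᵘ-ℤtoℚ (a ℤ.* b)))
     (ℚᵘ.≃-trans (ℚᵘ.≃-reflexive (sym (cong₂ ℚᵘ._*_ (toℚᵘ-ℤtoℚ a) (toℚᵘ-ℤtoℚ b))))
       (ℚᵘ.≃-sym (ℚ.toℚᵘ-homo-* (ℤtoℚ a) (ℤtoℚ b)))))

  ℤtoℚ-≢0 : ∀ z → ¬ z ≡ 0ℤ → ¬ ℤtoℚ z ≡ 0ℚ
  ℤtoℚ-≢0 z z≢0 e = z≢0 (trans (sym (cong ↥_ (ℤtoℚ-normal z))) (cong ↥_ e))

  ℕtoℚ-+ : ∀ a b → ℕtoℚ (a ℕ.+ b) ≡ ℕtoℚ a + ℕtoℚ b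
  ℕtoℚ-+ a b = ℤtoℚ-+ (+ a) (+ b)

  ℕtoℚ-* : ∀ a b → ℕtoℚ (a ℕ.* b) ≡ ℕtoℚ a * ℕtoℚ b
  ℕtoℚ-* a b = trans (cong ℤtoℚ (ℤ.pos-* a b)) (ℤtoℚ-* (+ a) (+ b))

  ℕtoℚ-suc≢0 : ∀ k → ¬ ℕtoℚ (suc k) ≡ 0ℚ
  ℕtoℚ-suc≢0 k = ℤtoℚ-≢0 (+ suc k) (λ ())

  *-≢0 : ∀ p r → ¬ p ≡ 0ℚ → ¬ r ≡ 0ℚ → ¬ p * r ≡ 0ℚ
  *-≢0 p r p≢0 r≢0 e = r≢0 (begin
      r                   ≡⟨ sym (ℚ.*-identityˡ r) ⟩
      1ℚ * r              ≡⟨ cong (_* r) (sym (ℚ.*-inverseˡ p)) ⟩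
      (1/ p) * p * r      ≡⟨ ℚ.*-assoc (1/ p) p r ⟩
      (1/ p) * (p * r)    ≡⟨ cong ((1/ p) *_) e ⟩
      (1/ p) * 0ℚ         ≡⟨ ℚ.*-zeroʳ (1/ p) ⟩
      0ℚ                  ∎)
    where
    open ≡-Reasoning
    instance _ = ℚ.≢-nonZero p≢0

  sumℚ : {A : Set} → (A → ℚ) → List A → ℚ
  sumℚ f [] = 0ℚ
  sumℚ f (x ∷ xs) = f x + sumℚ f xs

  ℤtoℚ-sumℤ : {A : Set} (f : A → ℤ) (xs : List A) → ℤtoℚ (sumℤ f xs) ≡ sumℚ (λ x → ℤtoℚ (f x)) xs
  ℤtoℚ-sumℤ f [] = refl
  ℤtoℚ-sumℤ f (x ∷ xs) = trans (ℤtoℚ-+ (f x) (sumℤ f xs)) (cong (λ z → ℤtoℚ (f x) + z) (ℤtoℚ-sumℤ f xs))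

module Binomial where

  open import Data.Nat as ℕ using (ℕ; zero; suc)
  import Data.Nat.Properties as ℕ
  open import Data.Rational as ℚ using (ℚ; _+_)
  open import Relation.Binary.PropositionalEquality
  open import Data.Nat.Solver using (module +-*-Solver)

  open +-*-Solver using (solve; _:+_; _:*_; _:=_; con)

  C : ℕ → ℕ → ℕ
  C n zero = 1
  C zero (suc k) = 0
  C (suc n) (suc k) = C n k ℕ.+ C n (suc k)

  C-absorption : ∀ t k → suc k ℕ.* C t (suc k) ℕ.+ k ℕ.* C t k ≡ t ℕ.* C t k
  C-absorption zero zero = refl
  C-absorption zero (suc k) = cong₂ ℕ._+_ (ℕ.*-zeroʳ (suc (suc k))) (ℕ.*-zeroʳ (suc k))
  C-absorption (suc t) zero = trans (ℕ.+-identityʳ _) (trans (ℕ.+-identityʳ (C (suc t) 1)) (trans (C-1 (suc t)) (sym (ℕ.*-identityʳ (suc t)))))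
    where
    C-1 : ∀ t → C t 1 ≡ t
    C-1 zero = refl
    C-1 (suc t) = cong suc (C-1 t)
  C-absorption (suc t) (suc k) =
    begin
      suc (suc k) ℕ.* (b ℕ.+ c) ℕ.+ suc k ℕ.* (a ℕ.+ b)
    ≡⟨ solve 5 (λ k t a b c → (con 2 :+ k) :* (b :+ c) :+ (con 1 :+ k) :* (a :+ b)
                           := ((con 2 :+ k) :* c :+ (con 1 :+ k) :* b) :+ ((con 1 :+ k) :* b :+ k :* a) :+ (b :+ a)) refl k t a b c ⟩
      (suc (suc k) ℕ.* c ℕ.+ suc k ℕ.* b) ℕ.+ (suc k ℕ.* b ℕ.+ k ℕ.* a) ℕ.+ (b ℕ.+ a)
    ≡⟨ cong₂ (λ u v → u ℕ.+ v ℕ.+ (b ℕ.+ a)) (C-absorption t (suc k)) (C-absorption t k) ⟩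
      t ℕ.* b ℕ.+ t ℕ.* a ℕ.+ (b ℕ.+ a)
    ≡⟨ solve 3 (λ t a b → t :* b :+ t :* a :+ (b :+ a) := (con 1 :+ t) :* (a :+ b)) refl t a b ⟩
      suc t ℕ.* (a ℕ.+ b)
    ∎
    where
    open ≡-Reasoning
    a b c : ℕ
    a = C t k
    b = C t (suc k)
    c = C t (suc (suc k))

  runningSum : {A : Set} → (A → A → A) → (ℕ → A) → ℕ → A
  runningSum _⊕_ f zero = f 0
  runningSum _⊕_ f (suc t) = runningSum _⊕_ f t ⊕ f (suc t)

  runningSum-cong : ∀ {A : Set} (_⊕_ : A → A → A) {f g} → (∀ k → f k ≡ g k) → ∀ t → runningSum _⊕_ f t ≡ runningSum _⊕_ g t
  runningSum-cong _⊕_ e zero = e 0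
  runningSum-cong _⊕_ e (suc t) = cong₂ _⊕_ (runningSum-cong _⊕_ e t) (e (suc t))

  runningSum-hom : ∀ {A : Set} (_⊕_ : A → A → A) (h : A → ℚ) → (∀ a b → h (a ⊕ b) ≡ h a + h b) →
                   ∀ f t → h (runningSum _⊕_ f t) ≡ runningSum _+_ (λ k → h (f k)) t
  runningSum-hom _⊕_ h h-+ f zero = refl
  runningSum-hom _⊕_ h h-+ f (suc t) =
    trans (h-+ (runningSum _⊕_ f t) (f (suc t))) (cong (_+ h (f (suc t))) (runningSum-hom _⊕_ h h-+ f t))

  hockey-stick : ∀ d t → runningSum ℕ._+_ (λ k → C k d) t ≡ C (suc t) (suc d)
  hockey-stick d zero = sym (ℕ.+-identityʳ (C 0 d))
  hockey-stick d (suc t) rewrite hockey-stick d t = ℕ.+-comm (C (suc t) (suc d)) (C (suc t) d)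

-- Polynomial functions ℕ → ℚ in the binomial basis C(t, 0), ..., C(t, d).
-- In this basis running sums are easy (hockey-stick identity): the running
-- sum of a polynomial of degree ≤ d has degree ≤ d + 1 and the same top
-- coefficient.
module BinomialBasis where

  open import Data.Nat as ℕ using (ℕ; zero; suc; _≤_)
  import Data.Nat.Properties as ℕ
  open import Data.Rational as ℚ using (ℚ; 0ℚ; _+_; _*_)
  import Data.Rational.Properties as ℚ
  open import Data.Vec as Vec using (Vec; []; _∷_; head; zipWith)
  open import Data.Bool using (if_then_else_)
  open import Relation.Nullary using (does)
  open import Relation.Nullary.Decidable using (dec-true; dec-false)
  open import Data.Product using (Σ; _,_; proj₁)
  open import Data.List using (List; []; _∷_)
  open import Data.List.Relation.Unary.All using (All; []; _∷_)
  open import Relation.Binary.PropositionalEquality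
  open import Data.Rational.Solver using (module +-*-Solver)
  open import Defs using (ℕtoℚ)
  open Rationals
  open Binomial

  open +-*-Solver using (solve; _:+_; _:*_; _:=_)

  runningSum-linear : ∀ (a : ℚ) f g t → runningSum _+_ (λ k → a * f k + g k) t ≡ a * runningSum _+_ f t + runningSum _+_ g t
  runningSum-linear a f g zero = refl
  runningSum-linear a f g (suc t) rewrite runningSum-linear a f g t =
    solve 5 (λ a x y u v → (a :* x :+ y) :+ (a :* u :+ v) := a :* (x :+ u) :+ (y :+ v)) refl
      a (runningSum _+_ f t) (runningSum _+_ g t) (f (suc t)) (g (suc t))

  runningSum-0 : ∀ t → runningSum _+_ (λ _ → 0ℚ) t ≡ 0ℚ
  runningSum-0 zero = refl
  runningSum-0 (suc t) rewrite runningSum-0 t = refl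

  -- evaluation in the binomial basis; the head of the vector is the
  -- coefficient of the highest binomial C(t, d - 1)
  evalBinomial : ∀ {d} → Vec ℚ d → ℕ → ℚ
  evalBinomial [] t = 0ℚ
  evalBinomial {suc d} (c ∷ cs) t = c * ℕtoℚ (C t d) + evalBinomial cs t

  BinomialPoly : ℕ → (ℕ → ℚ) → Set
  BinomialPoly d f = Σ (Vec ℚ (suc d)) (λ c → ∀ t → evalBinomial c t ≡ f t)

  topCoeff : ∀ {d f} → BinomialPoly d f → ℚ
  topCoeff p = head (proj₁ p)

  poly-cong : ∀ {d f g} → (∀ t → f t ≡ g t) → BinomialPoly d f → BinomialPoly d g
  poly-cong e (c , ev) = c , λ t → trans (ev t) (e t)

  poly-const : ∀ (a : ℚ) → BinomialPoly 0 (λ _ → a)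
  poly-const a = (a ∷ []) , λ t → trans (ℚ.+-identityʳ _) (ℚ.*-identityʳ a)

  poly-zero : ∀ d → BinomialPoly d (λ _ → 0ℚ)
  poly-zero d = Vec.replicate (suc d) 0ℚ , zeros (suc d)
    where
    zeros : ∀ d t → evalBinomial (Vec.replicate d 0ℚ) t ≡ 0ℚ
    zeros zero t = refl
    zeros (suc d) t rewrite zeros d t = trans (ℚ.+-identityʳ (0ℚ * ℕtoℚ (C t d))) (ℚ.*-zeroˡ (ℕtoℚ (C t d)))

  poly-+ : ∀ {d f g} (p : BinomialPoly d f) (q : BinomialPoly d g) →
           Σ (BinomialPoly d (λ t → f t + g t)) λ r → topCoeff r ≡ topCoeff p + topCoeff q
  poly-+ (a , ea) (b , eb) = (zipWith _+_ a b , λ t → trans (eval-+ a b t) (cong₂ _+_ (ea t) (eb t))) , top a b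
    where
    eval-+ : ∀ {d} (a b : Vec ℚ d) t → evalBinomial (zipWith _+_ a b) t ≡ evalBinomial a t + evalBinomial b t
    eval-+ [] [] t = refl
    eval-+ {suc d} (a ∷ as) (b ∷ bs) t rewrite eval-+ as bs t =
      solve 5 (λ a b k x y → (a :+ b) :* k :+ (x :+ y) := (a :* k :+ x) :+ (b :* k :+ y)) refl
        a b (ℕtoℚ (C t d)) (evalBinomial as t) (evalBinomial bs t)
    top : ∀ {d} (a b : Vec ℚ (suc d)) → head (zipWith _+_ a b) ≡ head a + head b
    top (x ∷ _) (y ∷ _) = refl

  poly-scale : ∀ {d f} s → BinomialPoly d f → BinomialPoly d (λ t → s * f t)
  poly-scale s (a , ea) = Vec.map (s *_) a , λ t → trans (eval-scale a t) (cong (s *_) (ea t))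
    where
    eval-scale : ∀ {d} (a : Vec ℚ d) t → evalBinomial (Vec.map (s *_) a) t ≡ s * evalBinomial a t
    eval-scale [] t = sym (ℚ.*-zeroʳ s)
    eval-scale {suc d} (a ∷ as) t rewrite eval-scale as t =
      solve 4 (λ s a k x → s :* a :* k :+ s :* x := s :* (a :* k :+ x)) refl s a (ℕtoℚ (C t d)) (evalBinomial as t)

  poly-raise : ∀ {d f} D → d ≤ D → (p : BinomialPoly d f) →
               Σ (BinomialPoly D f) λ r → topCoeff r ≡ (if does (d ℕ.≟ D) then topCoeff p else 0ℚ)
  poly-raise {d} {f} D d≤D (c , ev) = go (D ℕ.∸ d) D (ℕ.m∸n+n≡m d≤D)
    where
    pad : ∀ k → Vec ℚ (suc (k ℕ.+ d))
    pad zero = c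
    pad (suc k) = 0ℚ ∷ pad k
    pad-eval : ∀ k t → evalBinomial (pad k) t ≡ f t
    pad-eval zero t = ev t
    pad-eval (suc k) t = trans (cong (_+ evalBinomial (pad k) t) (ℚ.*-zeroˡ (ℕtoℚ (C t (suc (k ℕ.+ d))))))
                               (trans (ℚ.+-identityˡ _) (pad-eval k t))
    go : ∀ k D → k ℕ.+ d ≡ D → Σ (BinomialPoly D f) λ r → topCoeff r ≡ (if does (d ℕ.≟ D) then head c else 0ℚ)
    go zero _ refl = (c , ev) , cong (λ b → if b then head c else 0ℚ) (sym (dec-true (d ℕ.≟ d) refl))
    go (suc k) _ refl = (pad (suc k) , pad-eval (suc k)) ,
                        cong (λ b → if b then head c else 0ℚ)
                             (sym (dec-false (d ℕ.≟ suc k ℕ.+ d) (ℕ.m≢1+n+m d)))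

  -- running sums raise the degree by one and keep the top coefficient:
  -- by the hockey-stick identity, Σ_{k ≤ t} C(k, d) = C(t + 1, d + 1)
  poly-runningSum : ∀ {d f} (p : BinomialPoly d f) →
                    Σ (BinomialPoly (suc d) (runningSum _+_ f)) λ r → topCoeff r ≡ topCoeff p
  poly-runningSum (c , ec) = (sums c , λ t → trans (sums-eval c t) (runningSum-cong _+_ ec t)) , sums-head c
    where
    addHead : ∀ {d} → ℚ → Vec ℚ (suc d) → Vec ℚ (suc d)
    addHead a (x ∷ xs) = (a + x) ∷ xs

    addHead-eval : ∀ {d} a (v : Vec ℚ (suc d)) t → evalBinomial (addHead a v) t ≡ a * ℕtoℚ (C t d) + evalBinomial v t
    addHead-eval {d} a (x ∷ xs) t =
      solve 4 (λ a x k r → (a :+ x) :* k :+ r := a :* k :+ (x :* k :+ r)) refl a x (ℕtoℚ (C t d)) (evalBinomial xs t)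

    sums : ∀ {d} → Vec ℚ d → Vec ℚ (suc d)
    sums [] = 0ℚ ∷ []
    sums (a ∷ as) = a ∷ addHead a (sums as)

    sums-head : ∀ {d} (v : Vec ℚ (suc d)) → head (sums v) ≡ head v
    sums-head (a ∷ as) = refl

    sums-eval : ∀ {d} (c : Vec ℚ d) t → evalBinomial (sums c) t ≡ runningSum _+_ (evalBinomial c) t
    sums-eval [] t = trans (cong (_+ 0ℚ) (ℚ.*-zeroˡ (ℕtoℚ (C t 0)))) (sym (runningSum-0 t))
    sums-eval {suc d} (a ∷ as) t =
      begin
        a * ℕtoℚ (C t (suc d)) + evalBinomial (addHead a (sums as)) t
      ≡⟨ cong (a * ℕtoℚ (C t (suc d)) +_) (trans (addHead-eval a (sums as) t) (cong (a * ℕtoℚ (C t d) +_) (sums-eval as t))) ⟩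
        a * ℕtoℚ (C t (suc d)) + (a * ℕtoℚ (C t d) + runningSum _+_ (evalBinomial as) t)
      ≡⟨ solve 4 (λ a u v s → a :* u :+ (a :* v :+ s) := a :* (v :+ u) :+ s) refl
                 a (ℕtoℚ (C t (suc d))) (ℕtoℚ (C t d)) (runningSum _+_ (evalBinomial as) t) ⟩
        a * (ℕtoℚ (C t d) + ℕtoℚ (C t (suc d))) + runningSum _+_ (evalBinomial as) t
      ≡⟨ cong (λ z → a * z + runningSum _+_ (evalBinomial as) t)
              (trans (sym (ℕtoℚ-+ (C t d) (C t (suc d))))
                (trans (cong ℕtoℚ (sym (hockey-stick d t))) (runningSum-hom ℕ._+_ ℕtoℚ ℕtoℚ-+ (λ k → C k d) t))) ⟩
        a * runningSum _+_ (λ k → ℕtoℚ (C k d)) t + runningSum _+_ (evalBinomial as) t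
      ≡⟨ sym (runningSum-linear a (λ k → ℕtoℚ (C k d)) (evalBinomial as) t) ⟩
        runningSum _+_ (λ k → a * ℕtoℚ (C k d) + evalBinomial as k) t
      ∎
      where open ≡-Reasoning

  poly-sum : ∀ {A : Set} {D} (f : A → ℕ → ℚ) (top : A → ℚ) (xs : List A) →
             All (λ a → Σ (BinomialPoly D (f a)) λ p → topCoeff p ≡ top a) xs →
             Σ (BinomialPoly D (λ t → sumℚ (λ a → f a t) xs)) λ r → topCoeff r ≡ sumℚ top xs
  poly-sum {D = D} f top [] [] = poly-zero D , refl
  poly-sum f top (a ∷ xs) ((p , tp) ∷ ps) with poly-sum f top xs ps
  ... | (r , tr) with poly-+ p r
  ...   | (s , ts) = s , trans ts (cong₂ _+_ tp tr)

  poly-sum′ : ∀ {A : Set} {D} (f : A → ℕ → ℚ) (xs : List A) →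
              All (λ a → BinomialPoly D (f a)) xs → BinomialPoly D (λ t → sumℚ (λ a → f a t) xs)
  poly-sum′ {D = D} f [] [] = poly-zero D
  poly-sum′ f (a ∷ xs) (p ∷ ps) = proj₁ (poly-+ p (poly-sum′ f xs ps))

-- A polynomial in the binomial basis, evaluated at an
-- argument t = α + β x, is a polynomial in x in the monomial basis of the
-- statement (evalPoly, constant coefficient first).  For β ≠ 0 the binomial
-- C(α + β x, k) has degree exactly k in x, so a nonzero top coefficient
-- stays nonzero.
module MonomialBasis where

  open import Data.Nat as ℕ using (ℕ; zero; suc)
  open import Data.Rational as ℚ using (ℚ; 0ℚ; 1ℚ; _+_; _*_; _-_; 1/_)
  import Data.Rational.Properties as ℚ
  open import Data.Vec as Vec using (Vec; []; _∷_; _∷ʳ_; zipWith; last)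
  import Data.Vec.Properties as Vec
  open import Relation.Binary.PropositionalEquality
  open import Relation.Nullary using (¬_)
  open import Data.Rational.Solver using (module +-*-Solver)
  open import Defs using (ℕtoℚ; evalPoly)
  open Rationals
  open Binomial using (C; C-absorption)
  open BinomialBasis using (evalBinomial)

  open +-*-Solver using (solve; _:+_; _:*_; _:=_; con; _:-_)

  evalPoly-∷ʳ0 : ∀ {n} (v : Vec ℚ n) x → evalPoly (v ∷ʳ 0ℚ) x ≡ evalPoly v x
  evalPoly-∷ʳ0 [] x = trans (ℚ.+-identityˡ _) (ℚ.*-zeroʳ x)
  evalPoly-∷ʳ0 (c ∷ v) x = cong (λ z → c + x * z) (evalPoly-∷ʳ0 v x)

  evalPoly-+ : ∀ {n} (u v : Vec ℚ n) x → evalPoly (zipWith _+_ u v) x ≡ evalPoly u x + evalPoly v x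
  evalPoly-+ [] [] x = refl
  evalPoly-+ (a ∷ u) (b ∷ v) x rewrite evalPoly-+ u v x =
    solve 5 (λ a b x p q → (a :+ b) :+ x :* (p :+ q) := (a :+ x :* p) :+ (b :+ x :* q)) refl a b x (evalPoly u x) (evalPoly v x)

  evalPoly-scale : ∀ {n} s (v : Vec ℚ n) x → evalPoly (Vec.map (s *_) v) x ≡ s * evalPoly v x
  evalPoly-scale s [] x = sym (ℚ.*-zeroʳ s)
  evalPoly-scale s (c ∷ v) x rewrite evalPoly-scale s v x =
    solve 4 (λ s c x p → s :* c :+ x :* (s :* p) := s :* (c :+ x :* p)) refl s c x (evalPoly v x)

  last-zipWith : ∀ {n} (f : ℚ → ℚ → ℚ) (u v : Vec ℚ (suc n)) → last (zipWith f u v) ≡ f (last u) (last v)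
  last-zipWith {zero} f (a ∷ []) (b ∷ []) = refl
  last-zipWith {suc n} f (a ∷ u) (b ∷ v) = last-zipWith f u v

  last-map : ∀ {n} (f : ℚ → ℚ) (u : Vec ℚ (suc n)) → last (Vec.map f u) ≡ f (last u)
  last-map {zero} f (a ∷ []) = refl
  last-map {suc n} f (a ∷ u) = last-map f u

  mulLinear : ∀ {n} → ℚ → ℚ → Vec ℚ n → Vec ℚ (suc n)
  mulLinear a b p = zipWith _+_ (Vec.map (a *_) p ∷ʳ 0ℚ) (0ℚ ∷ Vec.map (b *_) p)

  mulLinear-eval : ∀ {n} a b (p : Vec ℚ n) x → evalPoly (mulLinear a b p) x ≡ (a + b * x) * evalPoly p x
  mulLinear-eval a b p x rewrite evalPoly-+ (Vec.map (a *_) p ∷ʳ 0ℚ) (0ℚ ∷ Vec.map (b *_) p) x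
    | evalPoly-∷ʳ0 (Vec.map (a *_) p) x | evalPoly-scale a p x | evalPoly-scale b p x =
    solve 4 (λ a b x p → a :* p :+ (con 0ℚ :+ x :* (b :* p)) := (a :+ b :* x) :* p) refl a b x (evalPoly p x)

  mulLinear-last : ∀ {n} a b (p : Vec ℚ (suc n)) → last (mulLinear a b p) ≡ b * last p
  mulLinear-last a b p =
    trans (last-zipWith _+_ (Vec.map (a *_) p ∷ʳ 0ℚ) (0ℚ ∷ Vec.map (b *_) p))
          (trans (cong₂ _+_ (Vec.last-∷ʳ 0ℚ (Vec.map (a *_) p)) (last-map (b *_) p)) (ℚ.+-identityˡ _))

  inverse : ℕ → ℚ
  inverse k = (1/ ℕtoℚ (suc k)) {{ℚ.≢-nonZero (ℕtoℚ-suc≢0 k)}}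

  inverse-cancel : ∀ k → ℕtoℚ (suc k) * inverse k ≡ 1ℚ
  inverse-cancel k = ℚ.*-inverseʳ (ℕtoℚ (suc k)) {{ℚ.≢-nonZero (ℕtoℚ-suc≢0 k)}}

  inverse-≢0 : ∀ k → ¬ inverse k ≡ 0ℚ
  inverse-≢0 k e = ℚ.1≢0 (trans (sym (inverse-cancel k)) (trans (cong (ℕtoℚ (suc k) *_) e) (ℚ.*-zeroʳ (ℕtoℚ (suc k)))))

  C-step : ∀ t k → ℕtoℚ (C t (suc k)) ≡ (ℕtoℚ t - ℕtoℚ k) * inverse k * ℕtoℚ (C t k)
  C-step t k =
    begin
      b                       ≡⟨ sym (trans (cong (b *_) (inverse-cancel k)) (ℚ.*-identityʳ b)) ⟩
      b * (k+1 * inverse k)   ≡⟨ solve 5 (λ b k1 i kq a → b :* (k1 :* i) := ((k1 :* b :+ kq :* a) :- kq :* a) :* i) refl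
                                   b k+1 (inverse k) (ℕtoℚ k) a ⟩
      ((k+1 * b + ℕtoℚ k * a) - ℕtoℚ k * a) * inverse k
                              ≡⟨ cong (λ z → (z - ℕtoℚ k * a) * inverse k) absorption ⟩
      (ℕtoℚ t * a - ℕtoℚ k * a) * inverse k
                              ≡⟨ solve 4 (λ t kq a i → (t :* a :- kq :* a) :* i := (t :- kq) :* i :* a) refl
                                   (ℕtoℚ t) (ℕtoℚ k) a (inverse k) ⟩
      (ℕtoℚ t - ℕtoℚ k) * inverse k * a
    ∎
    where
    open ≡-Reasoning
    a b k+1 : ℚ
    a = ℕtoℚ (C t k)
    b = ℕtoℚ (C t (suc k))
    k+1 = ℕtoℚ (suc k)
    absorption : k+1 * b + ℕtoℚ k * a ≡ ℕtoℚ t * a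
    absorption = trans (sym (trans (ℕtoℚ-+ (suc k ℕ.* C t (suc k)) (k ℕ.* C t k))
                                   (cong₂ _+_ (ℕtoℚ-* (suc k) (C t (suc k))) (ℕtoℚ-* k (C t k)))))
                       (trans (cong ℕtoℚ (C-absorption t k)) (ℕtoℚ-* t (C t k)))

  module ChangeOfVariable (α β : ℚ) where

    -- the monomial coefficients of x ↦ C(α + β x, k)
    binomialIn : (k : ℕ) → Vec ℚ (suc k)
    binomialIn zero = 1ℚ ∷ []
    binomialIn (suc k) = mulLinear ((α - ℕtoℚ k) * inverse k) (β * inverse k) (binomialIn k)

    binomialIn-eval : ∀ k x t → α + β * x ≡ ℕtoℚ t → evalPoly (binomialIn k) x ≡ ℕtoℚ (C t k)
    binomialIn-eval zero x t e = trans (cong (1ℚ +_) (ℚ.*-zeroʳ x)) (ℚ.+-identityʳ 1ℚ)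
    binomialIn-eval (suc k) x t e =
      begin
        evalPoly (mulLinear ((α - ℕtoℚ k) * inverse k) (β * inverse k) (binomialIn k)) x
      ≡⟨ mulLinear-eval ((α - ℕtoℚ k) * inverse k) (β * inverse k) (binomialIn k) x ⟩
        ((α - ℕtoℚ k) * inverse k + β * inverse k * x) * evalPoly (binomialIn k) x
      ≡⟨ cong₂ _*_ (solve 5 (λ a b k i x → (a :- k) :* i :+ b :* i :* x := ((a :+ b :* x) :- k) :* i) refl
                            α β (ℕtoℚ k) (inverse k) x)
                   (binomialIn-eval k x t e) ⟩
        ((α + β * x) - ℕtoℚ k) * inverse k * ℕtoℚ (C t k)
      ≡⟨ cong (λ u → (u - ℕtoℚ k) * inverse k * ℕtoℚ (C t k)) e ⟩
        (ℕtoℚ t - ℕtoℚ k) * inverse k * ℕtoℚ (C t k)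
      ≡⟨ sym (C-step t k) ⟩
        ℕtoℚ (C t (suc k))
      ∎
      where open ≡-Reasoning

    binomialIn-last : ¬ β ≡ 0ℚ → ∀ k → ¬ last (binomialIn k) ≡ 0ℚ
    binomialIn-last β≢0 zero = ℚ.1≢0
    binomialIn-last β≢0 (suc k) e =
      *-≢0 (β * inverse k) (last (binomialIn k)) (*-≢0 β (inverse k) β≢0 (inverse-≢0 k)) (binomialIn-last β≢0 k)
        (trans (sym (mulLinear-last ((α - ℕtoℚ k) * inverse k) (β * inverse k) (binomialIn k))) e)

    -- the monomial coefficients of x ↦ evalBinomial c (α + β x)
    toMonomial : ∀ {d} → Vec ℚ d → Vec ℚ d
    toMonomial [] = []
    toMonomial {suc d} (c ∷ cs) = zipWith _+_ (Vec.map (c *_) (binomialIn d)) (toMonomial cs ∷ʳ 0ℚ)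

    toMonomial-eval : ∀ {d} (c : Vec ℚ d) x t → α + β * x ≡ ℕtoℚ t → evalPoly (toMonomial c) x ≡ evalBinomial c t
    toMonomial-eval [] x t e = refl
    toMonomial-eval {suc d} (c ∷ cs) x t e =
      trans (evalPoly-+ (Vec.map (c *_) (binomialIn d)) (toMonomial cs ∷ʳ 0ℚ) x)
        (cong₂ _+_ (trans (evalPoly-scale c (binomialIn d) x) (cong (c *_) (binomialIn-eval d x t e)))
                   (trans (evalPoly-∷ʳ0 (toMonomial cs) x) (toMonomial-eval cs x t e)))

    toMonomial-last : ¬ β ≡ 0ℚ → ∀ {d} c (cs : Vec ℚ d) → ¬ c ≡ 0ℚ → ¬ last (toMonomial (c ∷ cs)) ≡ 0ℚ
    toMonomial-last β≢0 {d} c cs c≢0 e =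
      *-≢0 c (last (binomialIn d)) c≢0 (binomialIn-last β≢0 d)
        (trans (sym (trans (last-zipWith _+_ (Vec.map (c *_) (binomialIn d)) (toMonomial cs ∷ʳ 0ℚ))
                           (trans (cong₂ _+_ (last-map (c *_) (binomialIn d)) (Vec.last-∷ʳ 0ℚ (toMonomial cs)))
                                  (ℚ.+-identityʳ _))))
               e)

-- For the trivial sign, interleavings n (j + 1) is a running sum over n of
-- interleavings n j, so it is a polynomial of degree j with top binomial
-- coefficient 1 (it is C(n + j, j)).  For the parity sign the q-Pascal rule
-- at q = -1 gives the same recursion with step 2 in n and in j, so on even
-- and on odd n it is a polynomial in ⌊n/2⌋ of degree ⌊j/2⌋.
module InterleavingPolys where

  open import Data.Nat as ℕ using (ℕ; zero; suc; ⌊_/2⌋)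
  import Data.Nat.Properties as ℕ
  open import Data.Integer as ℤ using (ℤ; 0ℤ; 1ℤ; -_)
  import Data.Integer.Properties as ℤ
  open import Data.Rational using (0ℚ; 1ℚ)
  open import Data.Product using (Σ; _,_)
  open import Relation.Binary.PropositionalEquality
  open import Data.Integer.Solver using (module +-*-Solver)
  open import Defs using (ℤtoℚ)
  open Signs
  open Rationals using (ℤtoℚ-+)
  open Binomial using (runningSum; runningSum-hom)
  open BinomialBasis

  open +-*-Solver using (solve; _:+_; _:*_; _:=_; con; :-_)

  interleavings-0 : ∀ s n → interleavings s n 0 ≡ 1ℤ
  interleavings-0 s zero = refl
  interleavings-0 s (suc n) = interleavings-0 s n

  poly-running : ∀ {d} (g : ℕ → ℤ) (h : ℕ → ℤ) → (∀ t → g t ≡ runningSum ℤ._+_ h t) →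
                 (p : BinomialPoly d (λ t → ℤtoℚ (h t))) →
                 Σ (BinomialPoly (suc d) (λ t → ℤtoℚ (g t))) λ r → topCoeff r ≡ topCoeff p
  poly-running g h e p with poly-runningSum p
  ... | (r , top) = poly-cong (λ t → trans (sym (runningSum-hom ℤ._+_ ℤtoℚ ℤtoℚ-+ h t)) (cong ℤtoℚ (sym (e t)))) r , top

  module Trivial where

    g : ℕ → ℕ → ℤ
    g = interleavings trivialSign

    g-running : ∀ n j → g n (suc j) ≡ runningSum ℤ._+_ (λ k → g k j) n
    g-running zero j = refl
    g-running (suc n) j rewrite g-running n j =
      trans (cong (λ z → g (suc n) j ℤ.+ z) (ℤ.*-identityˡ _)) (ℤ.+-comm (g (suc n) j) _)

    poly : ∀ j → Σ (BinomialPoly j (λ n → ℤtoℚ (g n j))) λ p → topCoeff p ≡ 1ℚ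
    poly zero = poly-cong (λ n → cong ℤtoℚ (sym (interleavings-0 trivialSign n))) (poly-const 1ℚ) , refl
    poly (suc j) with poly j
    ... | (p , top) with poly-running (λ n → g n (suc j)) (λ n → g n j) (λ n → g-running n j) p
    ...   | (r , top′) = r , trans top′ top

  module Parity where

    g : ℕ → ℕ → ℤ
    g = interleavings paritySign

    double : ℕ → ℕ
    double zero = 0
    double (suc t) = suc (suc (double t))

    double≡2* : ∀ t → double t ≡ 2 ℕ.* t
    double≡2* zero = refl
    double≡2* (suc t) = trans (cong (λ k → suc (suc k)) (double≡2* t)) (cong suc (sym (ℕ.+-suc t (t ℕ.+ 0))))

    private
      σ : ℕ → ℤ
      σ = SignCharacter.σ paritySign
      σ-square : ∀ a → σ a ℤ.* σ a ≡ 1ℤ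
      σ-square = SignCharacter.σ-square paritySign

    -- the q-Pascal rule applied twice, at q = -1
    g-step2 : ∀ n j → g (suc (suc n)) (suc (suc j)) ≡ g n (suc (suc j)) ℤ.+ g (suc (suc n)) j
    g-step2 n j =
      trans (solve 4 (λ a b c p → (a :+ (:- p) :* b) :+ (:- (:- p)) :* (b :+ (:- (:- p)) :* c) := a :+ (p :* p) :* c) refl
                     (g (suc (suc n)) j) (g (suc n) (suc j)) (g n (suc (suc j))) (σ j))
        (trans (cong (λ z → g (suc (suc n)) j ℤ.+ z ℤ.* g n (suc (suc j))) (σ-square j))
          (trans (cong (λ z → g (suc (suc n)) j ℤ.+ z) (ℤ.*-identityˡ (g n (suc (suc j)))))
                 (ℤ.+-comm (g (suc (suc n)) j) (g n (suc (suc j))))))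

    g-1-step2 : ∀ j → g 1 (suc (suc j)) ≡ g 1 j
    g-1-step2 j = solve 2 (λ a p → (a :+ (:- p) :* con 1ℤ) :+ (:- (:- p)) :* con 1ℤ := a) refl (g 1 j) (σ j)

    g-running-even : ∀ t j → g (double t) (suc (suc j)) ≡ runningSum ℤ._+_ (λ k → g (double k) j) t
    g-running-even zero j = refl
    g-running-even (suc t) j = trans (g-step2 (double t) j) (cong (ℤ._+ g (double (suc t)) j) (g-running-even t j))

    g-running-odd : ∀ t j → g (suc (double t)) (suc (suc j)) ≡ runningSum ℤ._+_ (λ k → g (suc (double k)) j) t
    g-running-odd zero j = g-1-step2 j
    g-running-odd (suc t) j = trans (g-step2 (suc (double t)) j) (cong (ℤ._+ g (suc (double (suc t))) j) (g-running-odd t j))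

    g-n-1-step2 : ∀ n → g (suc (suc n)) 1 ≡ g n 1
    g-n-1-step2 n = solve 2 (λ x y → y :+ (:- con 1ℤ) :* (y :+ (:- con 1ℤ) :* x) := x) refl (g n 1) (g n 0)

    g-even-1 : ∀ t → g (double t) 1 ≡ 1ℤ
    g-even-1 zero = refl
    g-even-1 (suc t) = trans (g-n-1-step2 (double t)) (g-even-1 t)

    g-odd-1 : ∀ t → g (suc (double t)) 1 ≡ 0ℤ
    g-odd-1 zero = refl
    g-odd-1 (suc t) = trans (g-n-1-step2 (suc (double t))) (g-odd-1 t)

    poly-even : ∀ j → BinomialPoly ⌊ j /2⌋ (λ t → ℤtoℚ (g (double t) j))
    poly-even zero = poly-cong (λ t → cong ℤtoℚ (sym (interleavings-0 paritySign (double t)))) (poly-const 1ℚ)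
    poly-even (suc zero) = poly-cong (λ t → cong ℤtoℚ (sym (g-even-1 t))) (poly-const 1ℚ)
    poly-even (suc (suc j)) with poly-running (λ t → g (double t) (suc (suc j))) (λ t → g (double t) j)
                                              (λ t → g-running-even t j) (poly-even j)
    ... | (r , _) = r

    poly-odd : ∀ j → BinomialPoly ⌊ j /2⌋ (λ t → ℤtoℚ (g (suc (double t)) j))
    poly-odd zero = poly-cong (λ t → cong ℤtoℚ (sym (interleavings-0 paritySign (suc (double t))))) (poly-const 1ℚ)
    poly-odd (suc zero) = poly-cong (λ t → cong ℤtoℚ (sym (g-odd-1 t))) (poly-const 0ℚ)
    poly-odd (suc (suc j)) with poly-running (λ t → g (suc (double t)) (suc (suc j))) (λ t → g (suc (double t)) j)
                                             (λ t → g-running-odd t j) (poly-odd j)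
    ... | (r , _) = r

-- The free prefix of a window only contains elements incomparable with
-- x_{i0}, so its length is at most the number of such elements, which is
-- the degree bound incompSum of the statement.
module WindowBound (m0 : ℕ) (_≼₀_ : Rel (Fin m0) 0ℓ) (po : IsPartialOrder _≡_ _≼₀_)
                   (dec : Decidable _≼₀_) (i0 : Fin m0) (m : Fin m0 → ℕ) where

  open import Data.Nat using (suc; _≤_; z≤n; s≤s)
  import Data.Nat.Properties as ℕ
  open import Data.Nat.ListAction using (sum)
  open import Data.Fin using (_≟_)
  open import Data.Bool using (Bool; true; false; not; _∧_; _∨_; if_then_else_)
  open import Data.Bool.Properties using (∨-conicalˡ; ∨-conicalʳ)
  open import Data.Product using (Σ; _,_)
  open import Data.List using (List; []; _∷_; _++_; map; concat; concatMap; upTo; allFin)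
  import Data.List.Properties as List
  open import Data.List.Relation.Unary.All as All using (All; []; _∷_)
  import Data.List.Relation.Unary.All.Properties as All
  open import Relation.Binary.PropositionalEquality
  open import Relation.Nullary using (does; ¬_)
  open import Relation.Nullary.Decidable using (dec-true; dec-false)
  open import Defs
  open ListFacts
  open Lexicographic m0 _≼₀_ po dec i0
  open Growth m0 _≼₀_ po dec i0 m using (Eₙ; block; update-off)

  open IsPartialOrder po using () renaming (refl to ≼₀-refl)

  incomparable : E → Bool
  incomparable y = incomparableᵇ dec (idx y) i0

  ¬above⇒¬follows : ∀ y → below y ≡ false → above y ≡ false → does (dec i0 (idx y)) ≡ false
  ¬above⇒¬follows (i , j) ¬b ¬a = trans (sym (cong (λ c → not c ∧ does (dec i0 i)) (dec-false (i ≟ i0) i≢i0))) ¬a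
    where
    i≢i0 : ¬ i ≡ i0
    i≢i0 refl with () ← trans (sym (below-top j)) ¬b

  neither⇒incomparable : ∀ y → below y ≡ false → above y ≡ false → incomparable y ≡ true
  neither⇒incomparable y ¬b ¬a = cong₂ (λ a b → not a ∧ not b) ¬b (¬above⇒¬follows y ¬b ¬a)

  window-suffix : ∀ l → Σ (List E) λ p → p ++ window l ≡ l
  window-suffix [] = [] , refl
  window-suffix (y ∷ l) with anyBelow l | below y
  ... | true | _ with window-suffix l
  ...   | p , e = y ∷ p , cong (y ∷_) e
  window-suffix (y ∷ l) | false | true = y ∷ [] , refl
  window-suffix (y ∷ l) | false | false = [] , refl

  anyBelow-window : ∀ l → anyBelow (window l) ≡ false
  anyBelow-window [] = refl
  anyBelow-window (y ∷ l) with anyBelow l in e₁ | below y in e₂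
  ... | true | _ = anyBelow-window l
  ... | false | true = e₁
  ... | false | false = cong₂ _∨_ e₂ e₁

  count-window : ∀ (b : E → Bool) l → count b (window l) ≤ count b l
  count-window b l with window-suffix l
  ... | p , e = subst (count b (window l) ≤_) (trans (sym (count-++ b p (window l))) (cong (count b) e))
                  (ℕ.m≤n+m (count b (window l)) (count b p))

  freeLength≤incomparable : ∀ s → anyBelow s ≡ false → freeLength s ≤ count incomparable s
  freeLength≤incomparable [] _ = z≤n
  freeLength≤incomparable (y ∷ s) e = by-above (above y) refl
    where
    ¬b : below y ≡ false
    ¬b = ∨-conicalˡ (below y) (anyBelow s) e
    by-above : ∀ a → above y ≡ a → freeLength (y ∷ s) ≤ count incomparable (y ∷ s)
    by-above true ea = subst (_≤ count incomparable (y ∷ s)) (sym (cong (λ u → if u then 0 else suc (freeLength s)) ea)) z≤n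
    by-above false ea =
      subst₂ _≤_ (sym (cong (λ u → if u then 0 else suc (freeLength s)) ea))
                 (sym (trans (count-∷ incomparable y s) (cong (λ c → indicator c ℕ.+ count incomparable s)
                                                               (neither⇒incomparable y ¬b ea))))
                 (s≤s (freeLength≤incomparable s (∨-conicalʳ (below y) (anyBelow s) e)))

  freeLength-window≤ : ∀ l → freeLength (window l) ≤ count incomparable l
  freeLength-window≤ l = ℕ.≤-trans (freeLength≤incomparable (window l) (anyBelow-window l)) (count-window incomparable l)

  count-incomparable-E₀ : count incomparable (Eₙ 0) ≡ incompSum dec i0 m
  count-incomparable-E₀ =
    trans (count-concatMap (block (update m i0 0)) (allFin m0)) (sum-cong (allFin m0) block-count)
    where
    count-concatMap : ∀ (f : Fin m0 → List E) is → count incomparable (concatMap f is) ≡ sum (map (λ i → count incomparable (f i)) is)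
    count-concatMap f [] = refl
    count-concatMap f (i ∷ is) =
      trans (count-++ incomparable (f i) (concat (map f is))) (cong (count incomparable (f i) ℕ.+_) (count-concatMap f is))

    sum-cong : ∀ {f g : Fin m0 → ℕ} is → (∀ i → f i ≡ g i) → sum (map f is) ≡ sum (map g is)
    sum-cong [] e = refl
    sum-cong (i ∷ is) e = cong₂ ℕ._+_ (e i) (sum-cong is e)

    i0-comparable : incomparableᵇ dec i0 i0 ≡ false
    i0-comparable = cong (λ c → not c ∧ not c) (dec-true (dec i0 i0) ≼₀-refl)

    block-count : ∀ i → count incomparable (block (update m i0 0) i) ≡ (if incomparableᵇ dec i i0 then m i else 0)
    block-count i with incomparableᵇ dec i i0 in e
    ... | true = trans (count-allTrue incomparable _ (All.map⁺ (All.universal (λ j → e) (upTo (update m i0 0 i)))))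
                   (trans (List.length-map (i ,_) (upTo (update m i0 0 i)))
                     (trans (List.length-upTo (update m i0 0 i)) (update-off 0 i i≢i0)))
      where
      i≢i0 : ¬ i ≡ i0
      i≢i0 refl with () ← trans (sym e) i0-comparable
    ... | false = count-allFalse incomparable _ (All.map⁺ (All.universal (λ j → e) (upTo (update m i0 0 i))))

-- A linearization of the lexicographic sum with m_{i0} = 0 whose window
-- has a free prefix of full length incompSum: list the chains C_i in an
-- order extending ≼₀ in which the chains below x_{i0} come first, then
-- those incomparable with x_{i0}, then those above it.  It is obtained by
-- sorting the indices by the key (group, number of strict predecessors).
module Extremal (m0 : ℕ) (_≼₀_ : Rel (Fin m0) 0ℓ) (po : IsPartialOrder _≡_ _≼₀_)
                (dec : Decidable _≼₀_) (i0 : Fin m0) (m : Fin m0 → ℕ) where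

  open import Data.Nat using (suc; _≤_; _<_; z≤n; s≤s)
  import Data.Nat.Properties as ℕ
  open import Data.Fin using (_≟_)
  open import Data.Bool using (true; false; not; _∧_; _∨_; T; if_then_else_)
  open import Data.Bool.Properties using (∧-zeroʳ; ¬-not; ∨-conicalˡ; ∨-conicalʳ)
  open import Data.Empty using (⊥-elim)
  open import Data.Product using (_×_; _,_; proj₂)
  open import Data.List using (List; []; _∷_; concatMap; upTo; allFin)
  open import Data.List.Properties using (length-tabulate)
  open import Data.List.Relation.Unary.All as All using (All; []; _∷_)
  import Data.List.Relation.Unary.All.Properties as All
  open import Data.List.Relation.Unary.AllPairs as AllPairs using (AllPairs; []; _∷_)
  import Data.List.Relation.Unary.AllPairs.Properties as AllPairs
  open import Data.List.Membership.Propositional.Properties using (∈-allFin)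
  open import Data.List.Relation.Unary.Unique.Propositional.Properties using (allFin⁺)
  open import Data.List.Relation.Binary.Permutation.Propositional using (_↭_; ↭-sym)
  open import Relation.Binary.PropositionalEquality
  open import Relation.Nullary using (does; yes; no; ¬_)
  open import Relation.Nullary.Decidable using (dec-true; dec-false)
  open import Defs
  open ListFacts
  open Lexicographic m0 _≼₀_ po dec i0
  open Growth m0 _≼₀_ po dec i0 m using (Eₙ; block)
  open WindowBound m0 _≼₀_ po dec i0 m using (incomparable; neither⇒incomparable; count-incomparable-E₀)

  open IsPartialOrder po using () renaming (trans to ≼₀-trans; antisym to ≼₀-antisym)

  canPrecede-All : ∀ x l → All (λ y → y ≼ x ≡ false) l → canPrecede x l ≡ true
  canPrecede-All x [] [] = refl
  canPrecede-All x (y ∷ l) (e ∷ es) rewrite e | canPrecede-All x l es = refl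

  isLin-AllPairs : ∀ l → AllPairs (λ x y → y ≼ x ≡ false) l → isLin l ≡ true
  isLin-AllPairs [] [] = refl
  isLin-AllPairs (x ∷ l) (x⋠ ∷ ps) rewrite canPrecede-All x l x⋠ | isLin-AllPairs l ps = refl

  group : Fin m0 → ℕ
  group i = if does (dec i i0) then 0 else (if does (dec i0 i) then 2 else 1)

  group≤2 : ∀ i → group i ≤ 2
  group≤2 i with does (dec i i0) | does (dec i0 i)
  ... | true | _ = z≤n
  ... | false | true = ℕ.≤-refl
  ... | false | false = s≤s z≤n

  group-mono : ∀ i i' → i ≼₀ i' → group i ≤ group i'
  group-mono i i' p with dec i' i0 | dec i0 i'
  ... | yes q | _ rewrite dec-true (dec i i0) (≼₀-trans p q) = z≤n
  ... | no _ | yes _ = group≤2 i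
  ... | no _ | no i0⋠i' with dec i i0 | dec i0 i
  ...   | yes _ | _ = z≤n
  ...   | no _ | yes r = ⊥-elim (i0⋠i' (≼₀-trans r p))
  ...   | no _ | no _ = ℕ.≤-refl

  -- the number of strict predecessors, which increases along ≺₀
  rank : Fin m0 → ℕ
  rank i = count (λ k → does (dec k i) ∧ not (does (k ≟ i))) (allFin m0)

  rank-mono : ∀ i i' → i ≼₀ i' → ¬ i ≡ i' → rank i < rank i'
  rank-mono i i' p i≢i' = count-mono-< _ _ widen (allFin m0) (∈-allFin i) not-own own
    where
    widen : ∀ k → does (dec k i) ∧ not (does (k ≟ i)) ≡ true → does (dec k i') ∧ not (does (k ≟ i')) ≡ true
    widen k e with dec k i | k ≟ i
    widen k () | no _ | _
    widen k () | yes _ | yes _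
    ... | yes q | no _ rewrite dec-true (dec k i') (≼₀-trans q p)
                             | dec-false (k ≟ i') (λ { refl → i≢i' (≼₀-antisym p q) }) = refl
    not-own : does (dec i i) ∧ not (does (i ≟ i)) ≡ false
    not-own rewrite dec-true (i ≟ i) refl = ∧-zeroʳ _
    own : does (dec i i') ∧ not (does (i ≟ i')) ≡ true
    own rewrite dec-true (dec i i') p | dec-false (i ≟ i') i≢i' = refl

  M : ℕ
  M = suc m0

  rank<M : ∀ i → rank i < M
  rank<M i = s≤s (subst (rank i ≤_) (length-tabulate (λ x → x)) (count-≤-length _ (allFin m0)))

  key : Fin m0 → ℕ
  key i = group i ℕ.* M ℕ.+ rank i

  key-strict : ∀ i i' → i ≼₀ i' → ¬ i ≡ i' → key i < key i'
  key-strict i i' p i≢i' = ℕ.+-mono-≤-< (ℕ.*-monoˡ-≤ M (group-mono i i' p)) (rank-mono i i' p i≢i')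

  key-group : ∀ a b → key a ≤ key b → group a ≤ group b
  key-group a b le with group a ℕ.≤? group b
  ... | yes q = q
  ... | no q = ⊥-elim (ℕ.<-irrefl refl (ℕ.<-≤-trans key-b<key-a le))
    where
    key-b<key-a : key b < key a
    key-b<key-a = ℕ.<-≤-trans (ℕ.+-monoʳ-< (group b ℕ.* M) (rank<M b))
                    (ℕ.≤-trans (subst (_≤ group a ℕ.* M) (ℕ.+-comm M (group b ℕ.* M)) (ℕ.*-monoˡ-≤ M (ℕ.≰⇒> q)))
                               (ℕ.m≤m+n _ _))

  open SortByKey key using (sort; sort-↭; sort-ordered)

  order : List (Fin m0)
  order = sort (allFin m0)

  order-spec : AllPairs (λ a b → ¬ a ≡ b × key a ≤ key b) order
  order-spec = AllPairs.zip (Unique-↭ (↭-sym (sort-↭ (allFin m0))) (allFin⁺ m0) , sort-ordered (allFin m0))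

  chain : Fin m0 → List E
  chain = block (update m i0 0)

  extremal : List E
  extremal = concatMap chain order

  extremal-↭ : extremal ↭ Eₙ 0
  extremal-↭ = concatMap-↭ chain (sort-↭ (allFin m0))

  AllPairs-chains : ∀ {R : E → E → Set} (is : List (Fin m0)) → All (λ i → AllPairs R (chain i)) is →
                    AllPairs (λ a b → All (λ x → All (R x) (chain b)) (chain a)) is → AllPairs R (concatMap chain is)
  AllPairs-chains is inside between = AllPairs.concat⁺ (All.map⁺ inside) (AllPairs.map⁺ between)

  All-chain : ∀ {P : E → Set} i → (∀ j → P (i , j)) → All P (chain i)
  All-chain i f = All.map⁺ (All.universal f (upTo (update m i0 0 i)))

  extremal-linear : isLin extremal ≡ true
  extremal-linear = isLin-AllPairs extremal
    (AllPairs-chains order (All.universal inside order) (AllPairs.map (λ {a} {b} r → between a b r) order-spec))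
    where
    inside : ∀ i → AllPairs (λ x y → y ≼ x ≡ false) (chain i)
    inside i = AllPairs.map⁺ (AllPairs.applyUpTo⁺₁ (λ j → j) (update m i0 0 i) (λ {j} {j'} j<j' _ → later j j' j<j'))
      where
      later : ∀ j j' → j < j' → (i , j') ≼ (i , j) ≡ false
      later j j' j<j' rewrite dec-true (i ≟ i) refl =
        ¬-not (λ e → ℕ.<-irrefl refl (ℕ.<-≤-trans j<j' (ℕ.≤ᵇ⇒≤ j' j (subst T (sym e) _))))
    between : ∀ a b → ¬ a ≡ b × key a ≤ key b → All (λ x → All (λ y → y ≼ x ≡ false) (chain b)) (chain a)
    between a b (a≢b , le) = All-chain a (λ j → All-chain b (λ j' → later j j'))
      where
      later : ∀ j j' → (b , j') ≼ (a , j) ≡ false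
      later j j' rewrite dec-false (b ≟ a) (λ e → a≢b (sym e)) with dec b a
      ... | yes p = ⊥-elim (ℕ.<-irrefl refl (ℕ.<-≤-trans (key-strict b a p (λ e → a≢b (sym e))) le))
      ... | no _ = refl

  groupE : E → ℕ
  groupE y = group (idx y)

  freeLength-grouped : ∀ l → AllPairs (λ x y → groupE x ≤ groupE y) l → anyBelow l ≡ false →
                       freeLength l ≡ count incomparable l
  freeLength-grouped [] _ _ = refl
  freeLength-grouped (y ∷ l) (y≤ ∷ ps) e = by-above (above y) refl
    where
    ¬b : below y ≡ false
    ¬b = ∨-conicalˡ (below y) (anyBelow l) e
    group-2 : ∀ z → above z ≡ true → below z ≡ false → groupE z ≡ 2
    group-2 z a b = trans (cong (λ c → if c then 0 else (if does (dec i0 (idx z)) then 2 else 1)) b)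
                          (cong (λ c → if c then 2 else 1) (¬-not (λ f → case (trans (sym (¬above⇒ f)) a))))
      where
      ¬above⇒ : does (dec i0 (idx z)) ≡ false → above z ≡ false
      ¬above⇒ f = trans (cong (not (does (idx z ≟ i0)) ∧_) f) (∧-zeroʳ _)
      case : false ≡ true → _
      case ()
    group-2⇒comparable : ∀ z → groupE z ≡ 2 → incomparable z ≡ false
    group-2⇒comparable z g with dec (idx z) i0 | dec i0 (idx z)
    group-2⇒comparable z () | yes _ | _
    ... | no _ | yes _ = refl
    group-2⇒comparable z () | no _ | no _
    by-above : ∀ a → above y ≡ a → freeLength (y ∷ l) ≡ count incomparable (y ∷ l)
    by-above true ea =
      trans (cong (λ u → if u then 0 else suc (freeLength l)) ea)
        (sym (trans (count-∷ incomparable y l)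
               (cong₂ ℕ._+_ (cong indicator (group-2⇒comparable y g2))
                            (count-allFalse incomparable l
                               (All.map (λ {z} le → group-2⇒comparable z (ℕ.≤-antisym (group≤2 (idx z)) (subst (_≤ groupE z) g2 le))) y≤)))))
      where g2 = group-2 y ea ¬b
    by-above false ea =
      trans (cong (λ u → if u then 0 else suc (freeLength l)) ea)
        (sym (trans (count-∷ incomparable y l)
               (cong₂ ℕ._+_ (cong indicator (neither⇒incomparable y ¬b ea))
                            (sym (freeLength-grouped l ps (∨-conicalʳ (below y) (anyBelow l) e))))))

  freeLength-window-grouped : ∀ l → AllPairs (λ x y → groupE x ≤ groupE y) l → freeLength (window l) ≡ count incomparable l
  freeLength-window-grouped [] _ = refl
  freeLength-window-grouped (y ∷ l) (y≤ ∷ ps) = by-cases (anyBelow l) refl (below y) refl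
    where
    below⇒comparable : below y ≡ true → incomparable y ≡ false
    below⇒comparable b = cong (λ c → not c ∧ not (does (dec i0 (idx y)))) b
    below-later : anyBelow l ≡ true → below y ≡ true
    below-later = go l y≤
      where
      group-0 : ∀ z → below z ≡ true → groupE z ≡ 0
      group-0 z b = cong (λ c → if c then 0 else (if does (dec i0 (idx z)) then 2 else 1)) b
      from-group-0 : ∀ z → groupE z ≡ 0 → below z ≡ true
      from-group-0 z g with dec (idx z) i0 | dec i0 (idx z)
      ... | yes _ | _ = refl
      from-group-0 z () | no _ | yes _
      from-group-0 z () | no _ | no _
      go : ∀ l → All (λ z → groupE y ≤ groupE z) l → anyBelow l ≡ true → below y ≡ true
      go (z ∷ l) (le ∷ les) e = step (below z) refl
        where
        step : ∀ b → below z ≡ b → below y ≡ true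
        step true bz = from-group-0 y (ℕ.n≤0⇒n≡0 (subst (groupE y ≤_) (group-0 z bz) le))
        step false bz = go l les (trans (sym (cong (_∨ anyBelow l) bz)) e)
    drop-y : incomparable y ≡ false → count incomparable l ≡ count incomparable (y ∷ l)
    drop-y e = sym (trans (count-∷ incomparable y l) (cong (λ c → indicator c ℕ.+ count incomparable l) e))
    by-cases : ∀ a → anyBelow l ≡ a → ∀ b → below y ≡ b → freeLength (window (y ∷ l)) ≡ count incomparable (y ∷ l)
    by-cases true ea _ _ =
      trans (cong (λ c → freeLength (if c then window l else (if below y then l else y ∷ l))) ea)
        (trans (freeLength-window-grouped l ps) (drop-y (below⇒comparable (below-later ea))))
    by-cases false ea true eb =
      trans (cong₂ (λ c d → freeLength (if c then window l else (if d then l else y ∷ l))) ea eb)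
        (trans (freeLength-grouped l ps ea) (drop-y (below⇒comparable eb)))
    by-cases false ea false eb =
      trans (cong₂ (λ c d → freeLength (if c then window l else (if d then l else y ∷ l))) ea eb)
        (freeLength-grouped (y ∷ l) (y≤ ∷ ps) (cong₂ _∨_ eb ea))

  extremal-window : freeLength (window extremal) ≡ incompSum dec i0 m
  extremal-window =
    trans (freeLength-window-grouped extremal grouped)
          (trans (count-↭ incomparable extremal-↭) count-incomparable-E₀)
    where
    grouped : AllPairs (λ x y → groupE x ≤ groupE y) extremal
    grouped = AllPairs-chains order
      (All.universal (λ i → AllPairs.map⁺ (AllPairs.applyUpTo⁺₂ (λ j → j) (update m i0 0 i) (λ _ _ → ℕ.≤-refl))) order)
      (AllPairs.map (λ {a} {b} r → All-chain a (λ j → All-chain b (λ j' → key-group a b (proj₂ r)))) order-spec)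

module Theorem (m0 : ℕ) (_≼₀_ : Rel (Fin m0) 0ℓ) (po : IsPartialOrder _≡_ _≼₀_)
               (dec : Decidable _≼₀_) (i0 : Fin m0) (m : Fin m0 → ℕ) where

  open import Data.Nat using (zero; suc; _≤_; z≤n; s≤s; ⌊_/2⌋; _/_; _*_; _+_)
  import Data.Nat.Properties as ℕ
  import Data.Nat.DivMod as ℕ
  open import Data.Integer as ℤ using (ℤ; +_; 0ℤ; 1ℤ)
  import Data.Integer.Properties as ℤ
  open import Data.Rational as ℚ using (ℚ; 0ℚ; 1ℚ)
  import Data.Rational.Properties as ℚ
  open import Data.Vec using (Vec; _∷_; last)
  open import Data.Bool using (Bool; true; false; _∧_; if_then_else_)
  open import Data.Product using (Σ; _×_; _,_; proj₁; proj₂)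
  open import Data.List using (List; []; _∷_; filter; length; map; foldr)
  open import Data.List.Relation.Unary.All as All using (All; []; _∷_)
  open import Relation.Binary.PropositionalEquality
  open import Relation.Nullary using (does; ¬_)
  open import Relation.Nullary.Decidable using (T?; dec-true)
  open import Data.List.Relation.Binary.Permutation.Propositional using (↭-sym)
  import Data.Vec
  open import Data.Rational.Solver using (module +-*-Solver)
  open +-*-Solver using (solve; _:+_; _:*_; _:=_; con; :-_)
  open import Defs
  open ListSums
  open ListFacts
  open Signs
  open Rationals
  open BinomialBasis
  open MonomialBasis
  open InterleavingPolys
  open Lexicographic m0 _≼₀_ po dec i0
  open Growth m0 _≼₀_ po dec i0 m
  open WindowBound m0 _≼₀_ po dec i0 m using (incomparable; freeLength-window≤; count-incomparable-E₀)
  open Extremal m0 _≼₀_ po dec i0 m using (extremal; extremal-↭; extremal-linear; extremal-window)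

  S : ℕ
  S = incompSum dec i0 m

  orders : List (List E)
  orders = permutations (Eₙ 0)

  freeLength≤S : All (λ l → freeLength (window l) ≤ S) orders
  freeLength≤S = All.map (λ {l} c → ℕ.≤-trans (freeLength-window≤ l) (ℕ.≤-reflexive (trans c count-incomparable-E₀)))
                         (count-permutations incomparable (Eₙ 0))

  module Signed (sign : SignCharacter) where

    open SignCharacter sign
    open Insertion m0 _≼₀_ po dec i0 sign
    open ClosedForm m0 _≼₀_ po dec i0 m sign
    open Iteration sign

    signedCount-closedForm : ∀ n → sumℤ (weight (λ _ → 1ℤ)) (permutations (Eₙ n)) ≡ sumℤ (weight (closedForm n)) orders
    signedCount-closedForm n =
      trans (sum-weights-Eₙ n (λ _ → 1ℤ))
            (sumℤ-cong (λ l → cong (λ z → if isLin l then σ (inversions l) ℤ.* z else 0ℤ) (insertTop^-one n (window l))) orders)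

  fromTerms : ∀ {D} (α β : ℚ) (x : ℕ → ℚ) → (∀ t → α ℚ.+ β ℚ.* x t ≡ ℕtoℚ t) →
              (f : ℕ → List E → ℤ) → All (λ l → BinomialPoly D (λ t → ℤtoℚ (f t l))) orders →
              Σ (Vec ℚ (suc D)) λ p → ∀ t → evalPoly p (x t) ≡ ℤtoℚ (sumℤ (f t) orders)
  fromTerms {D} α β x arg f terms =
    toMonomial (proj₁ total) ,
    λ t → trans (toMonomial-eval (proj₁ total) (x t) t (arg t)) (trans (proj₂ total t) (sym (ℤtoℚ-sumℤ (f t) orders)))
    where
    open ChangeOfVariable α β
    total : BinomialPoly D (λ t → sumℚ (λ l → ℤtoℚ (f t l)) orders)
    total = poly-sum′ (λ l t → ℤtoℚ (f t l)) orders terms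

  private
    ℤtoℚ-if : ∀ b (z : ℤ) → ℤtoℚ (if b then z else 0ℤ) ≡ (if b then ℤtoℚ z else 0ℚ)
    ℤtoℚ-if true z = refl
    ℤtoℚ-if false z = refl

  module Count where

    open Signed trivialSign
    open Insertion m0 _≼₀_ po dec i0 trivialSign using (weight)
    open ClosedForm m0 _≼₀_ po dec i0 m trivialSign using (closedForm)

    Lplus-weights : ∀ n → + Lplus dec (update m i0 n) ≡ sumℤ (weight (λ _ → 1ℤ)) (permutations (Eₙ n))
    Lplus-weights n = length-filter (permutations (Eₙ n))
      where
      length-filter : ∀ ls → + length (filter (λ l → T? (isLinearizationᵇ dec l)) ls) ≡ sumℤ (weight (λ _ → 1ℤ)) ls
      length-filter [] = refl
      length-filter (l ∷ ls) with isLin l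
      ... | true = cong (λ z → 1ℤ ℤ.+ z) (length-filter ls)
      ... | false = trans (length-filter ls) (sym (ℤ.+-identityˡ _))

    -- an order counts towards the top coefficient if it is a linearization
    -- whose free prefix has full length
    full : List E → Bool
    full l = isLin l ∧ does (freeLength (window l) ℕ.≟ S)

    -- each linearization contributes C(n + j, j), j its free length, a
    -- polynomial of degree j ≤ S; its coefficient in degree S is 1 iff j = S
    term : ∀ l → freeLength (window l) ≤ S →
           Σ (BinomialPoly S (λ n → ℤtoℚ (weight (closedForm n) l))) λ p → topCoeff p ≡ ℤtoℚ (if full l then 1ℤ else 0ℤ)
    term l j≤S with Trivial.poly (freeLength (window l))
    ... | (p , top) with poly-raise S j≤S p
    ...   | (r , top′) with isLin l
    ...     | true = poly-cong (λ n → cong ℤtoℚ (sym (trans (ℤ.*-identityˡ _)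
                                                         (ℤ.*-identityˡ (Trivial.g n (freeLength (window l))))))) r ,
                     trans top′ (trans (cong (λ c → if does (freeLength (window l) ℕ.≟ S) then c else 0ℚ) top)
                                             (sym (ℤtoℚ-if (does (freeLength (window l) ℕ.≟ S)) 1ℤ)))
    ...     | false = poly-zero S , refl

    top≢0 : ¬ sumℚ (λ l → ℤtoℚ (if full l then 1ℤ else 0ℤ)) orders ≡ 0ℚ
    top≢0 e = ℤtoℚ-≢0 (sumℤ indicatorℤ orders) count≢0 (trans (ℤtoℚ-sumℤ indicatorℤ orders) e)
      where
      indicatorℤ : List E → ℤ
      indicatorℤ l = if full l then 1ℤ else 0ℤ
      count≢0 : ¬ sumℤ indicatorℤ orders ≡ 0ℤ
      count≢0 e₀ with count full (permutations extremal)
                    | count-pos full (permutations extremal) (∈-permutations extremal)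
                        (cong₂ _∧_ extremal-linear (dec-true (freeLength (window extremal) ℕ.≟ S) extremal-window))
                    | trans (sym (trans (sumℤ-permutations-↭ (↭-sym extremal-↭) indicatorℤ)
                                        (sumℤ-indicator full (permutations extremal)))) e₀
      ... | suc _ | _ | ()

    countPolynomial : Σ (Vec ℚ (suc S)) λ p → (last p ≢ 0ℚ) × (∀ n → evalPoly p (ℕtoℚ n) ≡ ℕtoℚ (Lplus dec (update m i0 n)))
    countPolynomial = toMonomial coeffs , leading coeffs (proj₂ total) , value
      where
      open ChangeOfVariable 0ℚ 1ℚ
      total : Σ (BinomialPoly S (λ n → sumℚ (λ l → ℤtoℚ (weight (closedForm n) l)) orders)) λ r →
                topCoeff r ≡ sumℚ (λ l → ℤtoℚ (if full l then 1ℤ else 0ℤ)) orders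
      total = poly-sum (λ l n → ℤtoℚ (weight (closedForm n) l)) (λ l → ℤtoℚ (if full l then 1ℤ else 0ℤ))
                       orders (All.map (λ {l} → term l) freeLength≤S)
      coeffs : Vec ℚ (suc S)
      coeffs = proj₁ (proj₁ total)
      leading : ∀ (c : Vec ℚ (suc S)) → Data.Vec.head c ≡ sumℚ (λ l → ℤtoℚ (if full l then 1ℤ else 0ℤ)) orders →
                last (toMonomial c) ≢ 0ℚ
      leading (c ∷ cs) top = toMonomial-last (λ ()) c cs (λ c≡0 → top≢0 (trans (sym top) c≡0))
      value : ∀ n → evalPoly (toMonomial coeffs) (ℕtoℚ n) ≡ ℕtoℚ (Lplus dec (update m i0 n))
      value n = trans (toMonomial-eval coeffs (ℕtoℚ n) n (trans (ℚ.+-identityˡ _) (ℚ.*-identityˡ _)))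
                  (trans (proj₂ (proj₁ total) n)
                    (trans (sym (ℤtoℚ-sumℤ (λ l → weight (closedForm n) l) orders))
                      (cong ℤtoℚ (sym (trans (Lplus-weights n) (signedCount-closedForm n))))))

  module SignImbalance where

    open Signed paritySign
    open SignCharacter paritySign using (σ; σ-+; σ-even)
    open Insertion m0 _≼₀_ po dec i0 paritySign using (weight)
    open ClosedForm m0 _≼₀_ po dec i0 m paritySign using (closedForm)
    open Parity using (g; double; double≡2*; poly-even; poly-odd)

    Lminus-weights : ∀ n → Lminus dec (update m i0 n) ≡ sumℤ (weight (λ _ → 1ℤ)) (permutations (Eₙ n))
    Lminus-weights n = signed-filter (permutations (Eₙ n))
      where
      signed-filter : ∀ ls → foldr ℤ._+_ 0ℤ (map (λ l → parityFromInv (inversions l)) (filter (λ l → T? (isLinearizationᵇ dec l)) ls))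
                             ≡ sumℤ (weight (λ _ → 1ℤ)) ls
      signed-filter [] = refl
      signed-filter (l ∷ ls) with isLin l
      ... | true = cong₂ ℤ._+_ (sym (ℤ.*-identityʳ (σ (inversions l)))) (signed-filter ls)
      ... | false = trans (signed-filter ls) (sym (ℤ.+-identityˡ _))

    ⌊/2⌋-mono : ∀ {j} → j ≤ S → ⌊ j /2⌋ ≤ S / 2
    ⌊/2⌋-mono {j} j≤S = subst (_≤ S / 2) (ℕ.m*n/n≡m ⌊ j /2⌋ 2) (ℕ./-monoˡ-≤ 2 (ℕ.≤-trans (half*2≤ j) j≤S))
      where
      half*2≤ : ∀ j → ⌊ j /2⌋ * 2 ≤ j
      half*2≤ zero = z≤n
      half*2≤ (suc zero) = z≤n
      half*2≤ (suc (suc j)) = s≤s (s≤s (half*2≤ j))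

    term : ∀ l → freeLength (window l) ≤ S → (c : ℤ) (h : ℕ → ℤ) →
           BinomialPoly ⌊ freeLength (window l) /2⌋ (λ t → ℤtoℚ (h t)) →
           BinomialPoly (S / 2) (λ t → ℤtoℚ (if isLin l then c ℤ.* h t else 0ℤ))
    term l j≤S c h p with isLin l
    ... | true = poly-cong (λ t → sym (ℤtoℚ-* c (h t))) (proj₁ (poly-raise (S / 2) (⌊/2⌋-mono j≤S) (poly-scale (ℤtoℚ c) p)))
    ... | false = poly-zero (S / 2)

    private
      X : List E → ℕ
      X l = K + restLength (window l)

    -- on even and odd n the factor σ(n X) of the closed form is constant

    closedForm-even : ∀ t l → closedForm (2 * t) (window l) ≡ g (double t) (freeLength (window l))
    closedForm-even t l =
      trans (cong₂ ℤ._*_ (σ-even t (X l)) (cong (λ k → g k (freeLength (window l))) (sym (double≡2* t))))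
            (ℤ.*-identityˡ _)

    closedForm-odd : ∀ t l → closedForm (2 * t + 1) (window l) ≡ σ (X l) ℤ.* g (suc (double t)) (freeLength (window l))
    closedForm-odd t l =
      cong₂ ℤ._*_ (trans (cong σ (trans (ℕ.*-distribʳ-+ (X l) (2 * t) 1) (cong (λ z → 2 * t * X l + z) (ℕ.+-identityʳ (X l)))))
                    (trans (σ-+ (2 * t * X l) (X l)) (trans (cong (ℤ._* σ (X l)) (σ-even t (X l))) (ℤ.*-identityˡ _))))
                  (cong (λ k → g k (freeLength (window l))) (trans (ℕ.+-comm (2 * t) 1) (cong suc (sym (double≡2* t)))))

    even-term : ∀ t l → (if isLin l then σ (inversions l) ℤ.* g (double t) (freeLength (window l)) else 0ℤ)
                        ≡ weight (closedForm (2 * t)) l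
    even-term t l = cong (λ z → if isLin l then σ (inversions l) ℤ.* z else 0ℤ) (sym (closedForm-even t l))

    odd-term : ∀ t l → (if isLin l then σ (inversions l) ℤ.* σ (X l) ℤ.* g (suc (double t)) (freeLength (window l)) else 0ℤ)
                       ≡ weight (closedForm (2 * t + 1)) l
    odd-term t l = cong (λ z → if isLin l then z else 0ℤ)
                     (trans (ℤ.*-assoc (σ (inversions l)) _ _) (cong (σ (inversions l) ℤ.*_) (sym (closedForm-odd t l))))

    ½ : ℚ
    ½ = + 1 ℚ./ 2

    ℕtoℚ-2* : ∀ t → ℕtoℚ (2 * t) ≡ ℕtoℚ t ℚ.+ ℕtoℚ t
    ℕtoℚ-2* t = trans (ℕtoℚ-+ t (t + 0)) (cong (λ z → ℕtoℚ t ℚ.+ ℕtoℚ z) (ℕ.+-identityʳ t))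

    even-arg : ∀ t → 0ℚ ℚ.+ ½ ℚ.* ℕtoℚ (2 * t) ≡ ℕtoℚ t
    even-arg t = trans (ℚ.+-identityˡ _) (trans (cong (½ ℚ.*_) (ℕtoℚ-2* t))
                   (trans (solve 2 (λ h a → h :* (a :+ a) := (h :+ h) :* a) refl ½ (ℕtoℚ t)) (ℚ.*-identityˡ _)))

    odd-arg : ∀ t → ℚ.- ½ ℚ.+ ½ ℚ.* ℕtoℚ (2 * t + 1) ≡ ℕtoℚ t
    odd-arg t =
      trans (cong (λ z → ℚ.- ½ ℚ.+ ½ ℚ.* z) (trans (ℕtoℚ-+ (2 * t) 1) (cong (ℚ._+ 1ℚ) (ℕtoℚ-2* t))))
        (trans (solve 2 (λ h a → (:- h) :+ h :* ((a :+ a) :+ con 1ℚ) := (h :+ h) :* a) refl ½ (ℕtoℚ t)) (ℚ.*-identityˡ _))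

    evenPolynomial : Σ (Vec ℚ (suc (S / 2))) λ p →
                     ∀ n → evalPoly p (ℕtoℚ (2 * n)) ≡ ℤtoℚ (Lminus dec (update m i0 (2 * n)))
    evenPolynomial =
      proj₁ even ,
      λ n → trans (proj₂ even n) (cong ℤtoℚ (sym (trans (Lminus-weights (2 * n)) (signedCount-closedForm (2 * n)))))
      where
      even : Σ (Vec ℚ (suc (S / 2))) λ p →
               ∀ t → evalPoly p (ℕtoℚ (2 * t)) ≡ ℤtoℚ (sumℤ (λ l → weight (closedForm (2 * t)) l) orders)
      even = fromTerms 0ℚ ½ (λ t → ℕtoℚ (2 * t)) even-arg (λ t l → weight (closedForm (2 * t)) l)
               (All.map (λ {l} j≤S → poly-cong (λ t → cong ℤtoℚ (even-term t l))
                           (term l j≤S (σ (inversions l)) (λ t → g (double t) (freeLength (window l)))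
                                 (poly-even (freeLength (window l))))) freeLength≤S)

    oddPolynomial : Σ (Vec ℚ (suc (S / 2))) λ p →
                    ∀ n → evalPoly p (ℕtoℚ (2 * n + 1)) ≡ ℤtoℚ (Lminus dec (update m i0 (2 * n + 1)))
    oddPolynomial =
      proj₁ odd ,
      λ n → trans (proj₂ odd n) (cong ℤtoℚ (sym (trans (Lminus-weights (2 * n + 1)) (signedCount-closedForm (2 * n + 1)))))
      where
      odd : Σ (Vec ℚ (suc (S / 2))) λ p →
              ∀ t → evalPoly p (ℕtoℚ (2 * t + 1)) ≡ ℤtoℚ (sumℤ (λ l → weight (closedForm (2 * t + 1)) l) orders)
      odd = fromTerms (ℚ.- ½) ½ (λ t → ℕtoℚ (2 * t + 1)) odd-arg (λ t l → weight (closedForm (2 * t + 1)) l)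
              (All.map (λ {l} j≤S → poly-cong (λ t → cong ℤtoℚ (odd-term t l))
                          (term l j≤S (σ (inversions l) ℤ.* σ (X l)) (λ t → g (suc (double t)) (freeLength (window l)))
                                (poly-odd (freeLength (window l))))) freeLength≤S)

open import Defs
open import Data.Nat using (suc; _*_; _/_; _+_)
open import Data.Rational using (ℚ; 0ℚ)
open import Data.Vec using (Vec; last)
open import Data.Product using (Σ; _×_; _,_; proj₁; proj₂)
open import Relation.Binary.PropositionalEquality using (_≢_)

proposition5p1 : (m0 : ℕ) (_≼₀_ : Rel (Fin m0) 0ℓ) → IsPartialOrder _≡_ _≼₀_ →
    (dec : Decidable _≼₀_) (i0 : Fin m0) (m : Fin m0 → ℕ) →
    (Σ (Vec ℚ (suc (incompSum dec i0 m))) λ p →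
    (last p ≢ 0ℚ) ×
    (∀ n → evalPoly p (ℕtoℚ n) ≡ ℕtoℚ (Lplus dec (update m i0 n))))
    ×
    (Σ (Vec ℚ (suc (incompSum dec i0 m / 2))) λ pₑ →
    Σ (Vec ℚ (suc (incompSum dec i0 m / 2))) λ pₒ →
    (∀ n → evalPoly pₑ (ℕtoℚ (2 * n)) ≡ ℤtoℚ (Lminus dec (update m i0 (2 * n)))) ×
    (∀ n → evalPoly pₒ (ℕtoℚ (2 * n + 1)) ≡ ℤtoℚ (Lminus dec (update m i0 (2 * n + 1)))))
proposition5p1 m0 _≼₀_ po dec i0 m =
  Count.countPolynomial ,
  (proj₁ SignImbalance.evenPolynomial , proj₁ SignImbalance.oddPolynomial ,
   proj₂ SignImbalance.evenPolynomial , proj₂ SignImbalance.oddPolynomial)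
  where
  open Theorem m0 _≼₀_ po dec i0 m
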